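{- If $T$ is a (finite) tree, then there is a decomposition of $T$ into UBVTs such that each vertex $v\in V(T)$ lies in at most $\lceil (d(v)+1)/3\rceil$ elements of the decomposition. Consequently $ub(T)\le \lceil (\Delta(T)+1)/3\rceil$.
   Context: A bar is a closed horizontal line segment of length $1$ in the plane. Two bars of an arrangement of pairwise disjoint bars see each other if there is an axis-parallel rectangle of positive width whose bottom side lies in one of them, whose top side lies in the other, and whose interior meets no bar of the arrangement. For a nonnegative integer $t$, a $t$-unit-bar visibility representation of a graph $G$ assigns to each vertex a set of at most $t$ bars, all bars pairwise disjoint, such that two distinct vertices are adjacent iff some bar of one sees some bar of the other; $ub(G)$ is the minimum such $t$. A unit bar visibility tree (UBVT) is a tree having a $1$-unit-bar visibility representation. A decomposition of $T$ into UBVTs is a collection of subtrees of $T$, each a UBVT, whose edge sets partition $E(T)$; a vertex lies in an element if it is a vertex of that subtree. $d(v)$ is the degree of $v$ in $T$ and $\Delta(T)$ the maximum degree. -}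

module Defs where

open import Data.Nat as ℕ using (ℕ; zero; suc; _∸_)
open import Data.Nat.DivMod using (_/_)
open import Data.Fin using (Fin)
open import Data.Bool using (Bool; true; false; if_then_else_; T)
open import Data.List using (List; []; _∷_; _++_; [_]; length; map; allFin; foldr)
open import Data.Nat.ListAction using (sum)
open import Data.Unit using (⊤)
open import Data.Empty using (⊥)
open import Data.List.Relation.Unary.Unique.Propositional using (Unique)
open import Data.Product using (Σ; ∃; ∃-syntax; _×_; _,_)
open import Data.Sum using (_⊎_)
open import Relation.Binary.PropositionalEquality using (_≡_; _≢_)
open import Relation.Nullary using (¬_)
open import Function.Bundles using (_⇔_)
open import Data.Rational using (ℚ; _+_; _<_; _≤_; 1ℚ)

-- Finite simple graphs on a subset of Fin n

record Graph (n : ℕ) : Set where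
  field
    vert   : Fin n → Bool
    adj    : Fin n → Fin n → Bool
    sym    : ∀ u v → adj u v ≡ true → adj v u ≡ true
    irrefl : ∀ u → adj u u ≡ false
    adjV   : ∀ u v → adj u v ≡ true → (vert u ≡ true) × (vert v ≡ true)
open Graph public

module _ {n : ℕ} (G : Graph n) where

  data Walk : Fin n → Fin n → Set where
    here : ∀ {u} → Walk u u
    step : ∀ {u w v} → adj G u w ≡ true → Walk w v → Walk u v

  Chain : List (Fin n) → Set
  Chain []            = ⊤
  Chain (x ∷ [])      = ⊤
  Chain (x ∷ y ∷ xs)  = (adj G x y ≡ true) × Chain (y ∷ xs)

  IsCycle : List (Fin n) → Set
  IsCycle []       = ⊥
  IsCycle (x ∷ xs) = (2 ℕ.≤ length xs) × Unique (x ∷ xs) × Chain ((x ∷ xs) ++ [ x ])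

  Connected : Set
  Connected = ∀ u v → vert G u ≡ true → vert G v ≡ true → Walk u v

  Acyclic : Set
  Acyclic = ∀ x xs → ¬ IsCycle (x ∷ xs)

  IsTree : Set
  IsTree = (∃[ v ] vert G v ≡ true) × Connected × Acyclic

  degree : Fin n → ℕ
  degree v = sum (map (λ w → if adj G v w then 1 else 0) (allFin n))

  maxDegree : ℕ
  maxDegree = foldr ℕ._⊔_ 0 (map degree (allFin n))

-- Unit bars: a bar (x , y) is the closed segment [x, x+1] × {y}.

Bar : Set
Bar = ℚ × ℚ

bx : Bar → ℚ
bx (x , _) = x

by : Bar → ℚ
by (_ , y) = y

Disjoint : Bar → Bar → Set
Disjoint a b = (by a ≢ by b) ⊎ ((bx a + 1ℚ < bx b) ⊎ (bx b + 1ℚ < bx a))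

record BarAssignment (n : ℕ) : Set where
  field
    nb  : Fin n → ℕ
    bar : (v : Fin n) → Fin (nb v) → Bar
open BarAssignment public

Pos : ∀ {n} → BarAssignment n → Set
Pos {n} R = Σ (Fin n) (λ v → Fin (nb R v))

barAt : ∀ {n} (R : BarAssignment n) → Pos R → Bar
barAt R (v , i) = bar R v i

-- bar a (below) sees bar b (above) in the arrangement of R: there is a
-- rectangle [p,q] × [y_a, y_b] with p < q, bottom side inside a, top side
-- inside b, whose interior (p,q) × (y_a,y_b) meets no bar of R.
SeesUp : ∀ {n} → BarAssignment n → Bar → Bar → Set
SeesUp R a b = ∃[ p ] ∃[ q ]
  ( p < q × by a < by b
  × bx a ≤ p × q ≤ bx a + 1ℚ
  × bx b ≤ p × q ≤ bx b + 1ℚ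
  × (∀ (c : Pos R) →
       ¬ ( (by a < by (barAt R c)) × (by (barAt R c) < by b)
         × (bx (barAt R c) < q) × (p < bx (barAt R c) + 1ℚ))))

SeeEachOther : ∀ {n} → BarAssignment n → Bar → Bar → Set
SeeEachOther R a b = SeesUp R a b ⊎ SeesUp R b a

IsRep : ∀ {n} → ℕ → Graph n → BarAssignment n → Set
IsRep {n} t G R =
    (∀ v → nb R v ℕ.≤ t)
  × (∀ v → vert G v ≡ false → nb R v ≡ 0)
  × (∀ (c d : Pos R) → c ≢ d → Disjoint (barAt R c) (barAt R d))
  × (∀ u v → vert G u ≡ true → vert G v ≡ true → u ≢ v →
       (adj G u v ≡ true ⇔ (∃[ i ] ∃[ j ] SeeEachOther R (bar R u i) (bar R v j))))

HasRep : ∀ {n} → ℕ → Graph n → Set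
HasRep t G = ∃[ R ] IsRep t G R

UBVT : ∀ {n} → Graph n → Set
UBVT G = IsTree G × HasRep 1 G

record Decomposition {n : ℕ} (T : Graph n) : Set where
  field
    k     : ℕ
    part  : Fin k → Graph n
    sub   : ∀ i u v → adj (part i) u v ≡ true → adj T u v ≡ true
    ubvt  : ∀ i → UBVT (part i)
    cover : ∀ u v → adj T u v ≡ true → ∃[ i ] adj (part i) u v ≡ true
    uniq  : ∀ u v i j → adj (part i) u v ≡ true → adj (part j) u v ≡ true → i ≡ j
open Decomposition public

load : ∀ {n} {T : Graph n} → Decomposition T → Fin n → ℕ
load D v = sum (map (λ i → if vert (part D i) v then 1 else 0) (allFin (k D)))

ceil3 : ℕ → ℕ
ceil3 m = (m ℕ.+ 2) / 3

module Submission where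

-- Root the tree T at a vertex r.  Every vertex v splits its children,
-- ordered by index, into consecutive triples; if v ≠ r, its first child is
-- not used there but continues the path through v and its parent.  A triple
-- together with v, each member extended downwards by repeatedly following
-- first children, forms a "spider": a top vertex v with at most three
-- vertical paths (legs) hanging from it.  Every edge of T is the upper edge of exactly one
-- non-root vertex, and each non-root vertex lies in one leg, so the spiders
-- partition E(T); a vertex v is the top of at most ⌈(d(v)+1)/3⌉ − [v ≠ r]
-- spiders, which gives the load bound.
--
-- A spider is a unit-bar visibility tree: its top is drawn at height 0,
-- two legs go straight up in columns overlapping the top bar only at its
-- ends, and the third leg goes straight down.  Drawing all spiders side by
-- side, far apart, yields a ⌈(Δ+1)/3⌉-bar representation of T itself.

open import Defs hiding (sym)

open import Data.Nat as N
  using (ℕ; zero; suc; _+_; _*_; _∸_; _≤_; _<_; _⊓_; z≤n; s≤s; _≡ᵇ_; _≤ᵇ_; _<ᵇ_)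
import Data.Nat.Properties as NP
open import Data.Nat.DivMod
  using (_/_; _%_; m≡m%n+[m/n]*n; [m+kn]%n≡m%n; m<n⇒m%n≡m; m/n≤m; m%n<n;
         m/n≡1+[m∸n]/n; /-monoˡ-≤)
open import Data.Nat.ListAction using (sum)
open import Data.Nat.Tactic.RingSolver using (solve-∀)
open import Data.Integer as Z using (ℤ) renaming (+_ to int)
import Data.Integer.Properties as ZP
open import Data.Rational as Q using (ℚ; 1ℚ)
open import Data.Rational.Literals using (fromℤ)
import Data.Rational.Properties as QP
open import Data.Fin as F using (Fin) renaming (zero to fzero; suc to fsuc)
import Data.Fin.Properties as FP
open import Data.Bool using (Bool; true; false; _∧_; _∨_; not; if_then_else_; T)
open import Data.Bool.Properties using (T-≡)
open import Data.List
  using (List; []; _∷_; _++_; [_]; map; length; lookup; downFrom; allFin; tabulate; foldr)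
import Data.List.Properties as LP
open import Data.List.Relation.Unary.Any using (here; there; index)
open import Data.List.Relation.Unary.Any.Properties using (lookup-index)
open import Data.List.Relation.Unary.All using (All; []; _∷_)
open import Data.List.Relation.Unary.AllPairs using (AllPairs; []; _∷_)
open import Data.List.Relation.Unary.Unique.Propositional using (Unique)
import Data.List.Relation.Unary.Unique.Propositional.Properties as UP
open import Data.List.Membership.Propositional using (_∈_)
import Data.List.Membership.Propositional.Properties as MP
open import Data.Product using (Σ; ∃; ∃-syntax; _×_; _,_; proj₁; proj₂)
open import Data.Sum using (_⊎_; inj₁; inj₂; [_,_]′)
open import Data.Empty using (⊥; ⊥-elim)
open import Data.Unit using (⊤; tt)
open import Relation.Binary using (tri<; tri≈; tri>)
open import Relation.Binary.PropositionalEquality hiding ([_]; J)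
open import Relation.Nullary using (¬_; yes; no; does)
open import Function using (_∘_)
open import Function.Bundles using (mk⇔; Equivalence)

∧-elimˡ : ∀ {a b} → a ∧ b ≡ true → a ≡ true
∧-elimˡ {true} _ = refl

∧-elimʳ : ∀ {a b} → a ∧ b ≡ true → b ≡ true
∧-elimʳ {true} p = p

∧-intro : ∀ {a b} → a ≡ true → b ≡ true → a ∧ b ≡ true
∧-intro refl refl = refl

∨-elim : ∀ {a b} → a ∨ b ≡ true → a ≡ true ⊎ b ≡ true
∨-elim {true} _ = inj₁ refl
∨-elim {false} p = inj₂ p

∨-introˡ : ∀ {a b} → a ≡ true → a ∨ b ≡ true
∨-introˡ refl = refl

∨-introʳ : ∀ {a b} → b ≡ true → a ∨ b ≡ true
∨-introʳ {true} _ = refl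
∨-introʳ {false} p = p

∨-swap : ∀ {a b} → a ∨ b ≡ true → b ∨ a ≡ true
∨-swap {a} {b} p with ∨-elim {a} p
... | inj₁ q = ∨-introʳ {b} q
... | inj₂ q = ∨-introˡ q

true≢false : ∀ {a} → a ≡ true → a ≡ false → ⊥
true≢false refl ()

¬true⇒false : ∀ {b} → (b ≡ true → ⊥) → b ≡ false
¬true⇒false {false} _ = refl
¬true⇒false {true} f = ⊥-elim (f refl)

not-intro : ∀ {a} → a ≡ false → not a ≡ true
not-intro refl = refl

not-elim : ∀ {a} → not a ≡ true → a ≡ false
not-elim {false} _ = refl

T⇒true : ∀ {b} → T b → b ≡ true
T⇒true = Equivalence.to T-≡

ind : Bool → ℕ
ind b = if b then 1 else 0

ind≤1 : ∀ b → ind b ≤ 1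
ind≤1 true = s≤s z≤n
ind≤1 false = z≤n

ind-∨ : ∀ a b → ind (a ∨ b) ≤ ind a + ind b
ind-∨ true b = s≤s z≤n
ind-∨ false b = NP.≤-refl

ind-disjoint-≤ : ∀ {a b c} → (a ≡ true → b ≡ true) → (c ≡ true → b ≡ true) →
  (a ≡ true → c ≡ true → ⊥) → ind a + ind c ≤ ind b
ind-disjoint-≤ {true} {b} {true} f g h = ⊥-elim (h refl refl)
ind-disjoint-≤ {true} {b} {false} f g h rewrite f refl = NP.≤-refl
ind-disjoint-≤ {false} {b} {true} f g h rewrite g refl = NP.≤-refl
ind-disjoint-≤ {false} {b} {false} f g h = z≤n

module _ {n : ℕ} where

  eqFin : Fin n → Fin n → Bool
  eqFin u v = does (u F.≟ v)

  eqFin-sound : ∀ {u v} → eqFin u v ≡ true → u ≡ v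
  eqFin-sound {u} {v} p with u F.≟ v
  ... | yes e = e

  eqFin-refl : ∀ u → eqFin u u ≡ true
  eqFin-refl u with u F.≟ u
  ... | yes _ = refl
  ... | no ne = ⊥-elim (ne refl)

  eqFin-complete : ∀ {u v} → u ≡ v → eqFin u v ≡ true
  eqFin-complete {u} refl = eqFin-refl u

  eqFin-≢ : ∀ {u v} → u ≢ v → eqFin u v ≡ false
  eqFin-≢ {u} {v} ne with u F.≟ v
  ... | yes e = ⊥-elim (ne e)
  ... | no _ = refl

  eqFin-false : ∀ {u v} → eqFin u v ≡ false → u ≢ v
  eqFin-false p e = true≢false (eqFin-complete e) p

≡ᵇ-sound : ∀ {u v} → (u ≡ᵇ v) ≡ true → u ≡ v
≡ᵇ-sound {u} {v} p = NP.≡ᵇ⇒≡ u v (subst T (sym p) tt)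

≡ᵇ-refl : ∀ u → (u ≡ᵇ u) ≡ true
≡ᵇ-refl u = T⇒true (NP.≡⇒≡ᵇ u u refl)

≡ᵇ-≢ : ∀ {u v} → u ≢ v → (u ≡ᵇ v) ≡ false
≡ᵇ-≢ ne = ¬true⇒false (λ e → ne (≡ᵇ-sound e))

≤ᵇ-true : ∀ {i K} → i ≤ K → (i ≤ᵇ K) ≡ true
≤ᵇ-true le = T⇒true (NP.≤⇒≤ᵇ le)

≤ᵇ-false : ∀ {i K} → K < i → (i ≤ᵇ K) ≡ false
≤ᵇ-false {i} {K} lt = ¬true⇒false (λ e → NP.<⇒≱ lt (NP.≤ᵇ⇒≤ i K (subst T (sym e) tt)))

<ᵇ-true : ∀ {a b} → a < b → (a <ᵇ b) ≡ true
<ᵇ-true lt = T⇒true (NP.<⇒<ᵇ lt)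

<ᵇ-sound : ∀ {a b} → (a <ᵇ b) ≡ true → a < b
<ᵇ-sound {a} {b} e = NP.<ᵇ⇒< a b (subst T (sym e) tt)

<ᵇ-irrefl : ∀ m → (m <ᵇ m) ≡ false
<ᵇ-irrefl m = ¬true⇒false (λ e → NP.<-irrefl refl (<ᵇ-sound {m} {m} e))

anyFin : ∀ {m} → (Fin m → Bool) → Bool
anyFin {zero} f = false
anyFin {suc m} f = f fzero ∨ anyFin (f ∘ fsuc)

anyFin-intro : ∀ {m} (f : Fin m → Bool) x → f x ≡ true → anyFin f ≡ true
anyFin-intro f fzero p = ∨-introˡ p
anyFin-intro f (fsuc x) p = ∨-introʳ {f fzero} (anyFin-intro (f ∘ fsuc) x p)

anyFin-elim : ∀ {m} (f : Fin m → Bool) → anyFin f ≡ true → ∃[ x ] f x ≡ true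
anyFin-elim {suc m} f p with ∨-elim {f fzero} p
... | inj₁ q = fzero , q
... | inj₂ q with anyFin-elim (f ∘ fsuc) q
... | x , q' = fsuc x , q'

chooseFrom : ∀ {m} (f : Fin m → Bool) (d : Fin m) (b : Bool) → anyFin f ≡ b → Fin m
chooseFrom f d true eq = proj₁ (anyFin-elim f eq)
chooseFrom f d false eq = d

choose : ∀ {m} (f : Fin m → Bool) (d : Fin m) → Fin m
choose f d = chooseFrom f d (anyFin f) refl

choose-spec : ∀ {m} (f : Fin m → Bool) (d : Fin m) → anyFin f ≡ true → f (choose f d) ≡ true
choose-spec f d p = spec (anyFin f) refl p
  where
  spec : ∀ b (eq : anyFin f ≡ b) → b ≡ true → f (chooseFrom f d b eq) ≡ true
  spec true eq _ = proj₂ (anyFin-elim f eq)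

sumFin : ∀ {m} → (Fin m → ℕ) → ℕ
sumFin {zero} g = 0
sumFin {suc m} g = g fzero + sumFin (g ∘ fsuc)

sumFin≡sum : ∀ {m} (g : Fin m → ℕ) → sumFin g ≡ sum (map g (allFin m))
sumFin≡sum {m} g = trans (sumFin≡tabulate g) (cong sum (sym (LP.map-tabulate (λ x → x) g)))
  where
  sumFin≡tabulate : ∀ {m} (g : Fin m → ℕ) → sumFin g ≡ sum (tabulate g)
  sumFin≡tabulate {zero} g = refl
  sumFin≡tabulate {suc m} g = cong (g fzero +_) (sumFin≡tabulate (g ∘ fsuc))

sumFin-mono : ∀ {m} (f g : Fin m → ℕ) → (∀ x → f x ≤ g x) → sumFin f ≤ sumFin g
sumFin-mono {zero} f g h = z≤n
sumFin-mono {suc m} f g h = NP.+-mono-≤ (h fzero) (sumFin-mono (f ∘ fsuc) (g ∘ fsuc) (h ∘ fsuc))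

+-interchange : ∀ a b c d → a + b + (c + d) ≡ a + c + (b + d)
+-interchange = solve-∀

sumFin-+ : ∀ {m} (f g : Fin m → ℕ) → sumFin (λ x → f x + g x) ≡ sumFin f + sumFin g
sumFin-+ {zero} f g = refl
sumFin-+ {suc m} f g = trans (cong (f fzero + g fzero +_) (sumFin-+ (f ∘ fsuc) (g ∘ fsuc)))
  (+-interchange (f fzero) (g fzero) _ _)

sumFin-ind≥1 : ∀ {m} (f : Fin m → Bool) x → f x ≡ true → 1 ≤ sumFin (ind ∘ f)
sumFin-ind≥1 f fzero p rewrite p = s≤s z≤n
sumFin-ind≥1 f (fsuc x) p = NP.≤-trans (sumFin-ind≥1 (f ∘ fsuc) x p) (NP.m≤n+m _ (ind (f fzero)))

sumFin-ind≤size : ∀ {m} (f : Fin m → Bool) → sumFin (ind ∘ f) ≤ m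
sumFin-ind≤size {zero} f = z≤n
sumFin-ind≤size {suc m} f = NP.+-mono-≤ (ind≤1 (f fzero)) (sumFin-ind≤size (f ∘ fsuc))

-- The least j ≤ L with f j, provided f L holds (bounded minimisation).
firstTrue : (ℕ → Bool) → ℕ → ℕ
firstTrue f zero = 0
firstTrue f (suc L) = if f 0 then 0 else suc (firstTrue (f ∘ suc) L)

firstTrue-true : ∀ (f : ℕ → Bool) L → f L ≡ true → f (firstTrue f L) ≡ true
firstTrue-true f zero p = p
firstTrue-true f (suc L) p with f 0 in e
... | true = e
... | false = firstTrue-true (f ∘ suc) L p

firstTrue-least : ∀ (f : ℕ → Bool) L j → f j ≡ true → firstTrue f L ≤ j
firstTrue-least f zero j p = z≤n
firstTrue-least f (suc L) j p with f 0 in e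
... | true = z≤n
firstTrue-least f (suc L) zero p | false = ⊥-elim (true≢false p e)
firstTrue-least f (suc L) (suc j) p | false = s≤s (firstTrue-least (f ∘ suc) L j p)

firstTrue-≤ : ∀ (f : ℕ → Bool) L → firstTrue f L ≤ L
firstTrue-≤ f zero = z≤n
firstTrue-≤ f (suc L) with f 0
... | true = z≤n
... | false = s≤s (firstTrue-≤ (f ∘ suc) L)

-- Bars on a grid
--
-- All bars we draw are `gridBar X Y`: left end at x = X/10 and height Y,
-- for X ∈ ℕ and Y ∈ ℤ; a unit bar then spans ten grid columns.  For such
-- bars visibility and disjointness reduce to integer arithmetic.

toℚ : ℤ → ℚ
toℚ = fromℤ

tenth : ℚ
tenth = int 1 Q./ 10

tenths : ℕ → ℚ
tenths X = toℚ (int X) Q.* tenth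

gridBar : ℕ → ℤ → Bar
gridBar X Y = (tenths X , toℚ Y)

toℚ-mono-< : ∀ {a b} → a Z.< b → toℚ a Q.< toℚ b
toℚ-mono-< {a} {b} p = Q.*<* (subst₂ Z._<_ (sym (ZP.*-identityʳ a)) (sym (ZP.*-identityʳ b)) p)

toℚ-cancel-< : ∀ {a b} → toℚ a Q.< toℚ b → a Z.< b
toℚ-cancel-< {a} {b} (Q.*<* p) = subst₂ Z._<_ (ZP.*-identityʳ a) (ZP.*-identityʳ b) p

toℚ-mono-≤ : ∀ {a b} → a Z.≤ b → toℚ a Q.≤ toℚ b
toℚ-mono-≤ {a} {b} p = Q.*≤* (subst₂ Z._≤_ (sym (ZP.*-identityʳ a)) (sym (ZP.*-identityʳ b)) p)

toℚ-injective : ∀ {a b} → toℚ a ≡ toℚ b → a ≡ b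
toℚ-injective p = cong Q.ℚ.numerator p

toℚ-+ : ∀ a b → toℚ a Q.+ toℚ b ≡ toℚ (a Z.+ b)
toℚ-+ a b = trans (cong (λ z → z Q./ 1) (cong₂ Z._+_ (ZP.*-identityʳ a) (ZP.*-identityʳ b)))
                (QP.↥p/↧p≡p (toℚ (a Z.+ b)))

tenths-+10 : ∀ X → tenths (X + 10) ≡ tenths X Q.+ 1ℚ
tenths-+10 X = begin
  toℚ (int (X + 10)) Q.* tenth     ≡⟨ cong (Q._* tenth) (sym (toℚ-+ (int X) (int 10))) ⟩
  (toℚ (int X) Q.+ toℚ (int 10)) Q.* tenth ≡⟨ QP.*-distribʳ-+ tenth (toℚ (int X)) (toℚ (int 10)) ⟩
  toℚ (int X) Q.* tenth Q.+ toℚ (int 10) Q.* tenth ≡⟨⟩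
  tenths X Q.+ 1ℚ ∎
  where open ≡-Reasoning

instance
  tenthPos : Q.Positive tenth
  tenthPos = _

tenths-mono-< : ∀ {a b} → a < b → tenths a Q.< tenths b
tenths-mono-< p = QP.*-monoˡ-<-pos tenth (toℚ-mono-< (Z.+<+ p))

tenths-mono-≤ : ∀ {a b} → a ≤ b → tenths a Q.≤ tenths b
tenths-mono-≤ p = QP.*-monoʳ-≤-nonNeg tenth (toℚ-mono-≤ (Z.+≤+ p))

tenths-cancel-< : ∀ {a b} → tenths a Q.< tenths b → a < b
tenths-cancel-< {a} {b} p with NP.<-cmp a b
... | tri< x _ _ = x
... | tri≈ _ refl _ = ⊥-elim (QP.<-irrefl refl p)
... | tri> _ _ y = ⊥-elim (QP.<-asym p (tenths-mono-< y))

module _ {n : ℕ} (R : BarAssignment n) where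

  seesUp-overlap : ∀ {Xa Ya Xb Yb} → SeesUp R (gridBar Xa Ya) (gridBar Xb Yb) →
    (Xb < Xa + 10) × (Xa < Xb + 10) × (Ya Z.< Yb)
  seesUp-overlap {Xa} {Ya} {Xb} {Yb} (p , q , p<q , ya<yb , a≤p , q≤a1 , b≤p , q≤b1 , _) =
    tenths-cancel-< (subst (tenths Xb Q.<_) (sym (tenths-+10 Xa)) (QP.≤-<-trans b≤p (QP.<-≤-trans p<q q≤a1))) ,
    tenths-cancel-< (subst (tenths Xa Q.<_) (sym (tenths-+10 Xb)) (QP.≤-<-trans a≤p (QP.<-≤-trans p<q q≤b1))) ,
    toℚ-cancel-< ya<yb

  seesUp-unblocked : ∀ {Xa Ya Xb Yb} → SeesUp R (gridBar Xa Ya) (gridBar Xb Yb) →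
    (c : Pos R) → ∀ {Xc Yc} → barAt R c ≡ gridBar Xc Yc → (Xc ≡ Xa ⊎ Xc ≡ Xb) →
    Ya Z.< Yc → Yc Z.< Yb → ⊥
  seesUp-unblocked {Xa} {Ya} {Xb} {Yb} (p , q , p<q , ya<yb , a≤p , q≤a1 , b≤p , q≤b1 , nb) c eq xc y1 y2 =
    nb c (subst (λ B → (toℚ Ya Q.< by B) × (by B Q.< toℚ Yb) × (bx B Q.< q) × (p Q.< bx B Q.+ 1ℚ)) (sym eq)
      (toℚ-mono-< y1 , toℚ-mono-< y2 , inColumn xc))
    where
    inColumn : ∀ {Xc} → (Xc ≡ Xa ⊎ Xc ≡ Xb) → (tenths Xc Q.< q) × (p Q.< tenths Xc Q.+ 1ℚ)
    inColumn (inj₁ refl) = QP.≤-<-trans a≤p p<q , QP.<-≤-trans p<q q≤a1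
    inColumn (inj₂ refl) = QP.≤-<-trans b≤p p<q , QP.<-≤-trans p<q q≤b1

  grid-seesUp : (∀ c → ∃[ Y ] by (barAt R c) ≡ toℚ Y) →
    ∀ {Xa Ya Xb Yb} (P Q : ℕ) → P < Q → Xa ≤ P → Q ≤ Xa + 10 → Xb ≤ P → Q ≤ Xb + 10 →
    Yb ≡ Z.suc Ya → SeesUp R (gridBar Xa Ya) (gridBar Xb Yb)
  grid-seesUp allI {Xa} {Ya} {Xb} {Yb} P Q P<Q a≤P Q≤a b≤P Q≤b refl =
    tenths P , tenths Q , tenths-mono-< P<Q , toℚ-mono-< (ZP.suc[i]≤j⇒i<j ZP.≤-refl) ,
    tenths-mono-≤ a≤P , subst (tenths Q Q.≤_) (tenths-+10 Xa) (tenths-mono-≤ Q≤a) ,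
    tenths-mono-≤ b≤P , subst (tenths Q Q.≤_) (tenths-+10 Xb) (tenths-mono-≤ Q≤b) ,
    λ c → no-bar-between c (allI c)
    where
    no-bar-between : ∀ c → ∃[ Y ] by (barAt R c) ≡ toℚ Y → ¬ ((toℚ Ya Q.< by (barAt R c)) × (by (barAt R c) Q.< toℚ (Z.suc Ya))
          × (bx (barAt R c) Q.< tenths Q) × (tenths P Q.< bx (barAt R c) Q.+ 1ℚ))
    no-bar-between c (Y , e) (h1 , h2 , _) =
      ZP.<-irrefl refl (ZP.<-≤-trans (toℚ-cancel-< (subst (Q._< toℚ (Z.suc Ya)) e h2))
                                      (ZP.i<j⇒suc[i]≤j (toℚ-cancel-< (subst (toℚ Ya Q.<_) e h1))))

grid-disjoint : ∀ {Xa Ya Xb Yb} → (Ya ≢ Yb) ⊎ (Xa + 10 < Xb) ⊎ (Xb + 10 < Xa) →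
  Disjoint (gridBar Xa Ya) (gridBar Xb Yb)
grid-disjoint (inj₁ ne) = inj₁ (λ e → ne (toℚ-injective e))
grid-disjoint {Xa} (inj₂ (inj₁ lt)) = inj₂ (inj₁ (subst (Q._< _) (tenths-+10 Xa) (tenths-mono-< lt)))
grid-disjoint {Xb = Xb} (inj₂ (inj₂ lt)) = inj₂ (inj₂ (subst (Q._< _) (tenths-+10 Xb) (tenths-mono-< lt)))

keep : ∀ {A : Set} → (A → Bool) → List A → List A
keep p [] = []
keep p (x ∷ xs) = if p x then x ∷ keep p xs else keep p xs

sumMap : ∀ {A : Set} → (A → ℕ) → List A → ℕ
sumMap f xs = sum (map f xs)

All≢⇒≢ : ∀ {A : Set} {x : A} {ys : List A} {z} → All (x ≢_) ys → z ∈ ys → x ≡ z → ⊥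
All≢⇒≢ (p ∷ _) (here refl) e = p e
All≢⇒≢ (_ ∷ ps) (there m) e = All≢⇒≢ ps m e

module _ {A : Set} where

  keep-∈⁺ : ∀ (p : A → Bool) {x xs} → x ∈ xs → p x ≡ true → x ∈ keep p (xs)
  keep-∈⁺ p {x} {y ∷ xs} (here refl) px rewrite px = here refl
  keep-∈⁺ p {x} {y ∷ xs} (there m) px with p y
  ... | true = there (keep-∈⁺ p m px)
  ... | false = keep-∈⁺ p m px

  keep-∈⁻ : ∀ (p : A → Bool) {x} xs → x ∈ keep p xs → (x ∈ xs) × (p x ≡ true)
  keep-∈⁻ p (y ∷ xs) m with p y in e
  keep-∈⁻ p (y ∷ xs) (here refl) | true = here refl , e
  keep-∈⁻ p (y ∷ xs) (there m) | true = let (a , b) = keep-∈⁻ p xs m in there a , b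
  ... | false = let (a , b) = keep-∈⁻ p xs m in there a , b

  keep-All : ∀ (p : A → Bool) {P : A → Set} xs → All P xs → All P (keep p xs)
  keep-All p [] [] = []
  keep-All p (y ∷ xs) (py ∷ a) with p y
  ... | true = py ∷ keep-All p xs a
  ... | false = keep-All p xs a

  keep-Unique : ∀ (p : A → Bool) xs → Unique xs → Unique (keep p xs)
  keep-Unique p [] u = []
  keep-Unique p (y ∷ xs) (a ∷ u) with p y
  ... | true = keep-All p xs a ∷ keep-Unique p xs u
  ... | false = keep-Unique p xs u

  length-keep : ∀ (p : A → Bool) xs → length (keep p xs) ≡ sumMap (ind ∘ p) xs
  length-keep p [] = refl
  length-keep p (y ∷ xs) with p y
  ... | true = cong suc (length-keep p xs)
  ... | false = length-keep p xs

  sumMap-keep-≤ : ∀ (p : A → Bool) (f : A → ℕ) xs → sumMap f (keep p xs) ≤ sumMap f xs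
  sumMap-keep-≤ p f [] = z≤n
  sumMap-keep-≤ p f (y ∷ xs) with p y
  ... | true = NP.+-monoʳ-≤ (f y) (sumMap-keep-≤ p f xs)
  ... | false = NP.≤-trans (sumMap-keep-≤ p f xs) (NP.m≤n+m _ (f y))

  sumMap-mono : ∀ (f g : A → ℕ) xs → (∀ x → x ∈ xs → f x ≤ g x) → sumMap f xs ≤ sumMap g xs
  sumMap-mono f g [] h = z≤n
  sumMap-mono f g (y ∷ xs) h = NP.+-mono-≤ (h y (here refl)) (sumMap-mono f g xs (λ x m → h x (there m)))

  sumMap-+ : ∀ (f g : A → ℕ) xs → sumMap (λ x → f x + g x) xs ≡ sumMap f xs + sumMap g xs
  sumMap-+ f g [] = refl
  sumMap-+ f g (y ∷ xs) = trans (cong (f y + g y +_) (sumMap-+ f g xs)) (+-interchange (f y) (g y) _ _)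

  sumMap-zero : ∀ (f : A → ℕ) xs → (∀ x → x ∈ xs → f x ≡ 0) → sumMap f xs ≡ 0
  sumMap-zero f [] h = refl
  sumMap-zero f (y ∷ xs) h = cong₂ _+_ (h y (here refl)) (sumMap-zero f xs (λ x m → h x (there m)))

  lookup-injective : ∀ (xs : List A) → Unique xs → ∀ i j → lookup xs i ≡ lookup xs j → i ≡ j
  lookup-injective (x ∷ xs) (a ∷ u) fzero fzero e = refl
  lookup-injective (x ∷ xs) (a ∷ u) fzero (fsuc j) e = ⊥-elim (All≢⇒≢ a (MP.∈-lookup j) e)
  lookup-injective (x ∷ xs) (a ∷ u) (fsuc i) fzero e = ⊥-elim (All≢⇒≢ a (MP.∈-lookup i) (sym e))
  lookup-injective (x ∷ xs) (a ∷ u) (fsuc i) (fsuc j) e = cong fsuc (lookup-injective xs u i j e)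

  sum-allFin-lookup : ∀ (f : A → ℕ) xs → sum (map (λ i → f (lookup xs i)) (allFin (length xs))) ≡ sumMap f xs
  sum-allFin-lookup f xs = trans (sym (sumFin≡sum (λ i → f (lookup xs i)))) (go xs)
    where
    go : ∀ xs → sumFin (λ i → f (lookup xs i)) ≡ sumMap f xs
    go [] = refl
    go (y ∷ ys) = cong (f y +_) (go ys)

count-unique≤1 : ∀ c xs → Unique xs → sumMap (λ x → ind (c ≡ᵇ x)) xs ≤ 1
count-unique≤1 c [] u = z≤n
count-unique≤1 c (y ∷ xs) (a ∷ u) with c NP.≟ y
... | yes refl rewrite ≡ᵇ-refl c = s≤s (NP.≤-reflexive (sumMap-zero _ xs z0))
  where
  z0 : ∀ x → x ∈ xs → ind (c ≡ᵇ x) ≡ 0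
  z0 x m rewrite ≡ᵇ-≢ {c} {x} (λ e → All≢⇒≢ a m e) = refl
... | no ne rewrite ≡ᵇ-≢ ne = count-unique≤1 c xs u

count-interval≤min : ∀ a b N → sumMap (λ x → ind ((a ≤ᵇ x) ∧ (x <ᵇ b))) (downFrom N) ≤ (N ⊓ b) ∸ a
count-interval≤min a b zero = z≤n
count-interval≤min a b (suc N) with a ≤ᵇ N in e1 | N <ᵇ b in e2
... | true | true =
  let aN = NP.≤ᵇ⇒≤ a N (subst T (sym e1) _)
      Nb = NP.<ᵇ⇒< N b (subst T (sym e2) _)
  in NP.≤-trans (s≤s (count-interval≤min a b N))
       (NP.≤-reflexive (trans (cong (λ t → suc (t ∸ a)) (NP.m≤n⇒m⊓n≡m (NP.<⇒≤ Nb)))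
          (trans (sym (NP.+-∸-assoc 1 aN)) (cong (_∸ a) (sym (NP.m≤n⇒m⊓n≡m Nb))))))
... | true | false = NP.≤-trans (count-interval≤min a b N) (NP.∸-monoˡ-≤ a (NP.⊓-monoˡ-≤ b (NP.n≤1+n N)))
... | false | _ = NP.≤-trans (count-interval≤min a b N) (NP.∸-monoˡ-≤ a (NP.⊓-monoˡ-≤ b (NP.n≤1+n N)))

count-interval : ∀ a b N → sumMap (λ x → ind ((a ≤ᵇ x) ∧ (x <ᵇ b))) (downFrom N) ≤ b ∸ a
count-interval a b N = NP.≤-trans (count-interval≤min a b N) (NP.∸-monoˡ-≤ a (NP.m⊓n≤n N b))

-- The rooted structure of a tree
--
-- The depth of v is its distance
-- to r (found by bounded search, using a walk from v to r as the bound), and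
-- the parent of v ≠ r is a neighbour of depth one less.  The key fact is
-- `edge-is-parent-edge`: every edge joins a vertex to its parent, for
-- otherwise the two paths to the root would close a cycle.

module _ {n : ℕ} {G : Graph n} where

  walk-++ : ∀ {u v w} → Walk G u v → Walk G v w → Walk G u w
  walk-++ here q = q
  walk-++ (step a p) q = step a (walk-++ p q)

  walk-reverse : ∀ {u v} → Walk G u v → Walk G v u
  walk-reverse here = here
  walk-reverse {u} (step {w = w} a p) = walk-++ (walk-reverse p) (step (Graph.sym G u w a) here)

module Tree {n : ℕ} (TG : Graph n) (allV : ∀ v → vert TG v ≡ true) (tr : IsTree TG) where

  r : Fin n
  r = proj₁ (proj₁ tr)

  conn : Connected TG
  conn = proj₁ (proj₂ tr)

  acyc : Acyclic TG
  acyc = proj₂ (proj₂ tr)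

  Adj : Fin n → Fin n → Set
  Adj u v = adj TG u v ≡ true

  Adj-sym : ∀ {u v} → Adj u v → Adj v u
  Adj-sym {u} {v} = Graph.sym TG u v

  Adj-irrefl : ∀ {u} → Adj u u → ⊥
  Adj-irrefl {u} p = true≢false p (Graph.irrefl TG u)

  within : ℕ → Fin n → Bool
  within zero v = eqFin v r
  within (suc k) v = within k v ∨ anyFin (λ w → adj TG v w ∧ within k w)

  walkLength : ∀ {u v} → Walk TG u v → ℕ
  walkLength here = 0
  walkLength (step _ w) = suc (walkLength w)

  within-step : ∀ {v w} k → Adj v w → within k w ≡ true → within (suc k) v ≡ true
  within-step {v} {w} k a p = ∨-introʳ {within k v} (anyFin-intro (λ x → adj TG v x ∧ within k x) w (∧-intro a p))

  within-walkLength : ∀ {v} (w : Walk TG v r) → within (walkLength w) v ≡ true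
  within-walkLength here = eqFin-refl r
  within-walkLength (step a w) = within-step (walkLength w) a (within-walkLength w)

  -- Connectivity gives a walk from v to r, hence an upper bound on the depth.
  walkBound : Fin n → ℕ
  walkBound v = walkLength (conn v r (allV v) (allV r))

  depth : Fin n → ℕ
  depth v = firstTrue (λ k → within k v) (walkBound v)

  depth-within : ∀ v → within (depth v) v ≡ true
  depth-within v = firstTrue-true (λ k → within k v) (walkBound v) (within-walkLength (conn v r (allV v) (allV r)))

  depth-least : ∀ v j → within j v ≡ true → depth v ≤ j
  depth-least v j p = firstTrue-least (λ k → within k v) (walkBound v) j p

  depth-root : depth r ≡ 0
  depth-root = NP.n≤0⇒n≡0 (depth-least r 0 (eqFin-refl r))

  depth≡0⇒root : ∀ {v} → depth v ≡ 0 → v ≡ r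
  depth≡0⇒root {v} e = eqFin-sound (subst (λ k → within k v ≡ true) e (depth-within v))

  depth-adj : ∀ {v w} → Adj v w → depth v ≤ suc (depth w)
  depth-adj {v} {w} a = depth-least v (suc (depth w)) (within-step (depth w) a (depth-within w))

  parentChoice : Fin n → Fin n
  parentChoice v = choose (λ w → adj TG v w ∧ within (N.pred (depth v)) w) r

  parent : Fin n → Fin n
  parent v = if eqFin v r then r else parentChoice v

  parent-nonroot : ∀ {v} → v ≢ r → parent v ≡ parentChoice v
  parent-nonroot {v} ne rewrite eqFin-≢ ne = refl

  private
    parentChoice-spec : ∀ v k → depth v ≡ suc k → Adj v (parentChoice v) × within k (parentChoice v) ≡ true
    parentChoice-spec v k e with ∨-elim {within k v} (subst (λ j → within j v ≡ true) e (depth-within v))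
    ... | inj₁ p = ⊥-elim (NP.<-irrefl refl (subst (_≤ k) e (depth-least v k p)))
    ... | inj₂ p =
      let q = choose-spec (λ w → adj TG v w ∧ within (N.pred (depth v)) w) r
                (subst (λ j → anyFin (λ w → adj TG v w ∧ within j w) ≡ true) (sym (cong N.pred e)) p)
      in ∧-elimˡ q , subst (λ j → within j (parentChoice v) ≡ true) (cong N.pred e) (∧-elimʳ q)

  depth-nonroot : ∀ {v} → v ≢ r → ∃[ k ] depth v ≡ suc k
  depth-nonroot {v} ne with depth v in e
  ... | zero = ⊥-elim (ne (depth≡0⇒root e))
  ... | suc k = k , refl

  parent-adj : ∀ {v} → v ≢ r → Adj v (parent v)
  parent-adj {v} ne with depth-nonroot ne
  ... | k , e = subst (Adj v) (sym (parent-nonroot ne)) (proj₁ (parentChoice-spec v k e))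

  depth-parent : ∀ {v} → v ≢ r → depth v ≡ suc (depth (parent v))
  depth-parent {v} ne with depth-nonroot ne
  ... | k , e = NP.≤-antisym (depth-adj (parent-adj ne))
     (subst (λ j → suc (depth j) ≤ depth v) (sym (parent-nonroot ne))
       (subst (suc (depth (parentChoice v)) ≤_) (sym e) (s≤s (depth-least (parentChoice v) k (proj₂ (parentChoice-spec v k e))))))

  n≢2+n : ∀ {a} → a ≡ suc (suc a) → ⊥
  n≢2+n {zero} ()
  n≢2+n {suc a} e = n≢2+n (NP.suc-injective e)

  parent-asym : ∀ {u w} → u ≢ r → w ≢ r → parent u ≡ w → parent w ≡ u → ⊥
  parent-asym {u} {w} un wn e1 e2 =
    n≢2+n (trans (depth-parent un) (cong suc (trans (cong depth e1) (trans (depth-parent wn) (cong (λ z → suc (depth z)) e2)))))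

  ancestor : ℕ → Fin n → Fin n
  ancestor zero v = v
  ancestor (suc k) v = parent (ancestor k v)

  depth-ancestor : ∀ k v → k ≤ depth v → depth (ancestor k v) + k ≡ depth v
  depth-ancestor zero v _ = NP.+-identityʳ (depth v)
  depth-ancestor (suc k) v le =
    let ih = depth-ancestor k v (NP.≤-trans (NP.n≤1+n k) le)
        ne : ancestor k v ≢ r
        ne e = NP.<-irrefl refl (NP.≤-trans le (NP.≤-reflexive (trans (sym ih)
                  (trans (cong (λ x → depth x + k) e) (cong (_+ k) depth-root)))))
    in trans (NP.+-suc _ k) (trans (cong (_+ k) (sym (depth-parent ne))) ih)

  ancestor-depth : ∀ v → ancestor (depth v) v ≡ r
  ancestor-depth v = depth≡0⇒root (NP.+-cancelʳ-≡ (depth v) _ 0 (depth-ancestor (depth v) v NP.≤-refl))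

  listOf : (ℕ → Fin n) → ℕ → List (Fin n)
  listOf f zero = []
  listOf f (suc L) = f 0 ∷ listOf (f ∘ suc) L

  listOf-length : ∀ f L → length (listOf f L) ≡ L
  listOf-length f zero = refl
  listOf-length f (suc L) = cong suc (listOf-length (f ∘ suc) L)

  listOf-All : ∀ {P : Fin n → Set} f L → (∀ i → i < L → P (f i)) → All P (listOf f L)
  listOf-All f zero h = []
  listOf-All f (suc L) h = h 0 (s≤s z≤n) ∷ listOf-All (f ∘ suc) L (λ i lt → h (suc i) (s≤s lt))

  listOf-distinct : ∀ f L → (∀ i j → i < L → j < L → f i ≡ f j → i ≡ j) → AllPairs _≢_ (listOf f L)
  listOf-distinct f zero h = []
  listOf-distinct f (suc L) h =
    listOf-All (f ∘ suc) L (λ i lt e → 0≢suc (h 0 (suc i) (s≤s z≤n) (s≤s lt) e)) ∷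
    listOf-distinct (f ∘ suc) L (λ i j li lj e → NP.suc-injective (h (suc i) (suc j) (s≤s li) (s≤s lj) e))
    where
    0≢suc : ∀ {i} → 0 ≡ suc i → ⊥
    0≢suc ()

  listOf-chain : ∀ f L c → (∀ i → suc i < suc L → Adj (f i) (f (suc i))) → Adj (f L) c →
    Chain TG (listOf f (suc L) ++ [ c ])
  listOf-chain f zero c h e = e , tt
  listOf-chain f (suc L) c h e = h 0 (s≤s (s≤s z≤n)) , listOf-chain (f ∘ suc) L c (λ i lt → h (suc i) (s≤s lt)) e

  noCycle : ∀ (f : ℕ → Fin n) L → 2 ≤ L →
    (∀ i j → i < suc L → j < suc L → f i ≡ f j → i ≡ j) →
    (∀ i → suc i < suc L → Adj (f i) (f (suc i))) → Adj (f L) (f 0) → ⊥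
  noCycle f L le inj ch cl =
    acyc (f 0) (listOf (f ∘ suc) L)
      (subst (2 ≤_) (sym (listOf-length (f ∘ suc) L)) le , listOf-distinct f (suc L) inj , listOf-chain f L (f 0) ch cl)

  [K+J]∸i<J : ∀ K J i → K < i → i ≤ K + J → (K + J) ∸ i < J
  [K+J]∸i<J zero (suc J) (suc i) lt le = s≤s (NP.m∸n≤m J i)
  [K+J]∸i<J (suc K) J (suc i) (s≤s lt) (s≤s le) = [K+J]∸i<J K J i lt le

  m∸n≡1+[m∸1+n] : ∀ M i → suc i ≤ M → M ∸ i ≡ suc (M ∸ suc i)
  m∸n≡1+[m∸1+n] (suc M) zero _ = refl
  m∸n≡1+[m∸1+n] (suc M) (suc i) (s≤s le) = m∸n≡1+[m∸1+n] M i le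

  nonRoot-above : ∀ {x i d} → depth x + i ≡ d → i < d → x ≢ r
  nonRoot-above {x} {i} e lt refl = NP.<-irrefl refl (subst (i <_) (sym (trans (sym (cong (_+ i) depth-root)) e)) lt)

  -- An edge uv with depth v = depth u + δ, where the ancestors of u and v
  -- first meet J ≥ 1 steps above u, closes the cycle
  --   v, parent v, …, ancestor (J+δ) v = ancestor J u, …, parent u, u, v.
  module CycleThrough {u v : Fin n} (a : Adj u v) (δ : ℕ) (eδ : depth v ≡ depth u + δ)
             (j1 : ℕ) (Jspec : ancestor (suc j1 + δ) v ≡ ancestor (suc j1) u)
             (Jmin : ∀ k → ancestor (k + δ) v ≡ ancestor k u → suc j1 ≤ k) (J≤ : suc j1 ≤ depth u) where

    J K M : ℕ
    J = suc j1
    K = J + δ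
    M = K + J

    cycle : ℕ → Fin n
    cycle i = if i ≤ᵇ K then ancestor i v else ancestor (M ∸ i) u

    climb : ∀ {i} → i ≤ K → cycle i ≡ ancestor i v
    climb {i} le rewrite ≤ᵇ-true le = refl

    descend : ∀ {i} → K < i → cycle i ≡ ancestor (M ∸ i) u
    descend {i} lt rewrite ≤ᵇ-false lt = refl

    K≤depth-v : K ≤ depth v
    K≤depth-v = subst (K ≤_) (sym eδ) (NP.+-monoˡ-≤ δ J≤)

    depth-climb : ∀ {i} → i ≤ K → depth (ancestor i v) + i ≡ depth v
    depth-climb le = depth-ancestor _ v (NP.≤-trans le K≤depth-v)

    depth-descend : ∀ {k} → k < J → depth (ancestor k u) + k ≡ depth u
    depth-descend lt = depth-ancestor _ u (NP.≤-trans (NP.<⇒≤ lt) J≤)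

    descent-index : ∀ {i} → K < i → i ≤ M → M ∸ i < J
    descent-index lt le = [K+J]∸i<J K J _ lt le

    climb≢descend : ∀ {i k} → i ≤ K → k < J → ancestor i v ≡ ancestor k u → ⊥
    climb≢descend {i} {k} le lt e =
      NP.<⇒≱ lt (Jmin k (subst (λ t → ancestor t v ≡ ancestor k u) ieq e))
      where
      d₀ : ℕ
      d₀ = depth (ancestor i v)
      ieq : i ≡ k + δ
      ieq = NP.+-cancelˡ-≡ d₀ i (k + δ)
        (trans (depth-climb le) (trans eδ (trans (cong (_+ δ) (sym (trans (cong (λ x → depth x + k) e) (depth-descend lt))))
          (trans (NP.+-assoc d₀ k δ) refl))))

    -- the cycle visits distinct vertices: on each side depths separate them,
    -- and a vertex on both sides would be a common ancestor below level J
    cycle-distinct : ∀ i j → i < suc M → j < suc M → cycle i ≡ cycle j → i ≡ j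
    cycle-distinct i j (s≤s li) (s≤s lj) e with i NP.≤? K | j NP.≤? K
    ... | yes pi | yes pj =
      let e' = trans (sym (climb pi)) (trans e (climb pj))
      in NP.+-cancelˡ-≡ (depth (ancestor i v)) i j (trans (depth-climb pi) (sym (trans (cong (λ x → depth x + j) e') (depth-climb pj))))
    ... | yes pi | no pj = ⊥-elim (climb≢descend pi (descent-index (NP.≰⇒> pj) lj) (trans (sym (climb pi)) (trans e (descend (NP.≰⇒> pj)))))
    ... | no pi | yes pj = ⊥-elim (climb≢descend pj (descent-index (NP.≰⇒> pi) li) (trans (sym (climb pj)) (trans (sym e) (descend (NP.≰⇒> pi)))))
    ... | no pi | no pj =
      let gi = NP.≰⇒> pi ; gj = NP.≰⇒> pj
          e' = trans (sym (descend gi)) (trans e (descend gj))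
          ki = descent-index gi li ; kj = descent-index gj lj
          keq = NP.+-cancelˡ-≡ (depth (ancestor (M ∸ i) u)) (M ∸ i) (M ∸ j)
                  (trans (depth-descend ki) (sym (trans (cong (λ x → depth x + (M ∸ j)) e') (depth-descend kj))))
      in NP.∸-cancelˡ-≡ li lj keq

    descent-step : ∀ {k} → k < J → Adj (ancestor (suc k) u) (ancestor k u)
    descent-step lt = Adj-sym (parent-adj (nonRoot-above (depth-descend lt) (NP.≤-trans lt J≤)))

    cycle-step : ∀ i → suc i < suc M → Adj (cycle i) (cycle (suc i))
    cycle-step i (s≤s si≤M) with suc i NP.≤? K
    ... | yes le = subst₂ Adj (sym (climb (NP.<⇒≤ le))) (sym (climb le))
                     (parent-adj (nonRoot-above (depth-climb (NP.<⇒≤ le)) (NP.<-≤-trans le K≤depth-v)))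
    ... | no gt with i NP.≤? K
    ...   | yes le =
      let iK : i ≡ K
          iK = NP.≤-antisym le (NP.≤-pred (NP.≰⇒> gt))
          idx : M ∸ suc i ≡ j1
          idx = trans (cong (λ t → M ∸ suc t) iK) (trans (cong (_∸ suc K) (NP.+-comm K J))
                  (trans (cong (_∸ suc K) (sym (NP.+-suc j1 K))) (NP.m+n∸n≡m j1 (suc K))))
      in subst₂ Adj (sym (trans (climb le) (trans (cong (λ t → ancestor t v) iK) Jspec)))
                  (sym (trans (descend (NP.≰⇒> gt)) (cong (λ t → ancestor t u) idx)))
                  (descent-step (s≤s NP.≤-refl))
    ...   | no gt' =
      let g1 = NP.≰⇒> gt' ; g2 = NP.≰⇒> gt
          e2 = m∸n≡1+[m∸1+n] M i si≤M
      in subst₂ Adj (sym (trans (descend g1) (cong (λ t → ancestor t u) e2))) (sym (descend g2))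
                  (descent-step (descent-index g2 si≤M))

    cycle-closes : Adj (cycle M) (cycle 0)
    cycle-closes = subst₂ Adj (sym (trans (descend KltM) (cong (λ t → ancestor t u) (NP.n∸n≡0 M)))) (sym (climb z≤n)) a
      where
      KltM : K < M
      KltM = subst (_≤ M) (NP.+-comm K 1) (NP.+-monoʳ-≤ K (s≤s z≤n))

    2≤M : 2 ≤ M
    2≤M = NP.+-mono-≤ (NP.≤-trans (s≤s z≤n) (NP.m≤m+n J δ)) (s≤s z≤n)

    impossible : ⊥
    impossible = noCycle cycle M 2≤M cycle-distinct cycle-step cycle-closes

  edge-downward : ∀ {u v} → Adj u v → depth u ≤ depth v → (v ≢ r) × (parent v ≡ u)
  edge-downward {u} {v} a le = vnr , pv
    where
    δ : ℕ
    δ = depth v ∸ depth u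
    eδ : depth v ≡ depth u + δ
    eδ = sym (NP.m+[n∸m]≡n le)
    δ≤1 : δ ≤ 1
    δ≤1 = subst (δ ≤_) (NP.m+n∸m≡n (depth u) 1)
            (subst (λ t → δ ≤ t ∸ depth u) (NP.+-comm 1 (depth u)) (NP.∸-monoˡ-≤ (depth u) (depth-adj (Adj-sym a))))
    vnr : v ≢ r
    vnr e = Adj-irrefl (subst (λ x → Adj x v) (trans (depth≡0⇒root (NP.n≤0⇒n≡0 (subst (depth u ≤_) (trans (cong depth e) depth-root) le))) (sym e)) a)
    g : ℕ → Bool
    g j = eqFin (ancestor (j + δ) v) (ancestor j u)
    gdu : g (depth u) ≡ true
    gdu = eqFin-complete (trans (cong (λ t → ancestor t v) (sym eδ)) (trans (ancestor-depth v) (sym (ancestor-depth u))))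
    j0 : ℕ
    j0 = firstTrue g (depth u)
    pv : parent v ≡ u
    pv with parent v F.≟ u
    ... | yes e = e
    ... | no np with j0 | firstTrue-true g (depth u) gdu | firstTrue-least g (depth u) | firstTrue-≤ g (depth u)
    ...   | zero | sp | _ | _ = ⊥-elim (shortEdge δ refl δ≤1 (eqFin-sound sp))
      where
      shortEdge : ∀ d → d ≡ δ → d ≤ 1 → ancestor d v ≡ u → ⊥
      shortEdge zero _ _ e = Adj-irrefl (subst (λ x → Adj u x) e a)
      shortEdge (suc zero) _ _ e = np e
      shortEdge (suc (suc _)) _ (s≤s ()) _
    ...   | suc j1 | sp | mn | ml =
      ⊥-elim (CycleThrough.impossible a δ eδ j1 (eqFin-sound sp) (λ k e → mn k (eqFin-complete e)) ml)

  edge-is-parent-edge : ∀ {u v} → Adj u v → ((v ≢ r) × (parent v ≡ u)) ⊎ ((u ≢ r) × (parent u ≡ v))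
  edge-is-parent-edge {u} {v} a with NP.≤-total (depth u) (depth v)
  ... | inj₁ le = inj₁ (edge-downward a le)
  ... | inj₂ le = inj₂ (edge-downward (Adj-sym a) le)

-- The spider decomposition
--
-- Children of a vertex v are ranked by their index.  A child x with
-- parent v gets the slot  rank x + shift x,  where shift x = 2 if v ≠ r
-- and 0 if v = r.  The slot splits into a group (slot / 3) and a leg
-- (slot mod 3).  The child of rank 0 of a non-root vertex (alone in group 0)
-- continues its parent's leg; every other child x starts a new leg of the
-- spider with top v and group childGroup x.
--
-- Following continuing children upwards, every non-root vertex x gets a
-- place: the top and group of its spider, its leg, and its index (distance
-- from the top) in that leg.  Spiders are numbered by the code
-- owner x = top · base + group, with base > every group.

module Spiders {n : ℕ} (TG : Graph n) (allV : ∀ v → vert TG v ≡ true) (tr : IsTree TG) where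
  open Tree TG allV tr public

  isChild : Fin n → Fin n → Bool
  isChild x v = not (eqFin x r) ∧ eqFin (parent x) v

  childCount : Fin n → ℕ
  childCount v = sumFin (λ w → ind (isChild w v))

  earlierSibling : Fin n → Fin n → Fin n → ℕ
  earlierSibling p x w = ind (isChild w p ∧ (F.toℕ w <ᵇ F.toℕ x))

  rank : Fin n → ℕ
  rank x = sumFin (earlierSibling (parent x) x)

  nonRoot-true : ∀ {x} → x ≢ r → not (eqFin x r) ≡ true
  nonRoot-true ne = not-intro (eqFin-≢ ne)

  nonRoot-sound : ∀ {x} → not (eqFin x r) ≡ true → x ≢ r
  nonRoot-sound p = eqFin-false (not-elim p)

  isChild-intro : ∀ {x} → x ≢ r → isChild x (parent x) ≡ true
  isChild-intro {x} ne = ∧-intro (nonRoot-true ne) (eqFin-refl (parent x))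

  isChild-elim : ∀ {x v} → isChild x v ≡ true → (x ≢ r) × (parent x ≡ v)
  isChild-elim {x} p = nonRoot-sound (∧-elimˡ p) , eqFin-sound (∧-elimʳ {not (eqFin x r)} p)

  rank-split : ∀ p x → suc (sumFin (earlierSibling p x)) ≤ sumFin (λ w → earlierSibling p x w + ind (eqFin w x))
  rank-split p x = NP.≤-trans (NP.≤-reflexive (NP.+-comm 1 (sumFin (earlierSibling p x))))
     (NP.≤-trans (NP.+-monoʳ-≤ (sumFin (earlierSibling p x)) (sumFin-ind≥1 (λ w → eqFin w x) x (eqFin-refl x)))
       (NP.≤-reflexive (sym (sumFin-+ (earlierSibling p x) (λ w → ind (eqFin w x))))))

  rank<childCount : ∀ {x} → x ≢ r → suc (rank x) ≤ childCount (parent x)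
  rank<childCount {x} ne = NP.≤-trans (rank-split (parent x) x)
    (sumFin-mono _ (λ w → ind (isChild w (parent x)))
      (λ w → ind-disjoint-≤ {isChild w (parent x) ∧ (F.toℕ w <ᵇ F.toℕ x)} {isChild w (parent x)} {eqFin w x}
         (∧-elimˡ {isChild w (parent x)})
         (λ e → subst (λ z → isChild z (parent x) ≡ true) (sym (eqFin-sound {u = w} {v = x} e)) (isChild-intro ne))
         (λ a e → true≢false (subst (λ z → (F.toℕ z <ᵇ F.toℕ x) ≡ true) (eqFin-sound e) (∧-elimʳ {isChild w (parent x)} a))
                            (<ᵇ-irrefl (F.toℕ x)))))

  rank-mono : ∀ {x y} → x ≢ r → parent x ≡ parent y → F.toℕ x < F.toℕ y → suc (rank x) ≤ rank y
  rank-mono {x} {y} ne e lt = NP.≤-trans (rank-split (parent x) x)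
    (sumFin-mono _ (earlierSibling (parent y) y)
      (λ w → ind-disjoint-≤ {isChild w (parent x) ∧ (F.toℕ w <ᵇ F.toℕ x)} {isChild w (parent y) ∧ (F.toℕ w <ᵇ F.toℕ y)} {eqFin w x}
          (λ a → ∧-intro (subst (λ p → isChild w p ≡ true) e (∧-elimˡ a))
                         (<ᵇ-true (NP.<-trans (<ᵇ-sound (∧-elimʳ {isChild w (parent x)} a)) lt)))
          (λ q → subst (λ z → (isChild z (parent y) ∧ (F.toℕ z <ᵇ F.toℕ y)) ≡ true) (sym (eqFin-sound q))
                   (∧-intro (subst (λ p → isChild x p ≡ true) e (isChild-intro ne)) (<ᵇ-true lt)))
          (λ a q → NP.<-irrefl refl (subst (λ z → F.toℕ z < F.toℕ x) (eqFin-sound q) (<ᵇ-sound (∧-elimʳ {isChild w (parent x)} a))))))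

  rank-injective : ∀ {x y} → x ≢ r → y ≢ r → parent x ≡ parent y → rank x ≡ rank y → x ≡ y
  rank-injective {x} {y} nx ny e re with NP.<-cmp (F.toℕ x) (F.toℕ y)
  ... | tri< lt _ _ = ⊥-elim (NP.<-irrefl re (rank-mono nx e lt))
  ... | tri≈ _ eq _ = FP.toℕ-injective eq
  ... | tri> _ _ gt = ⊥-elim (NP.<-irrefl (sym re) (rank-mono ny (sym e) gt))

  children+parent≤degree : ∀ v → childCount v + ind (not (eqFin v r)) ≤ sumFin (λ w → ind (adj TG v w))
  children+parent≤degree v = NP.≤-trans (NP.+-monoʳ-≤ (childCount v) (parentCount (eqFin v r) refl))
    (NP.≤-trans (NP.≤-reflexive (sym (sumFin-+ (λ w → ind (isChild w v)) (λ w → ind (isParentOf w)))))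
      (sumFin-mono _ _ (λ w → ind-disjoint-≤ {isChild w v} {adj TG v w} {isParentOf w}
        (λ c → let (wn , pw≡) = isChild-elim c in subst (λ z → Adj z w) pw≡ (Adj-sym (parent-adj wn)))
        (λ c → subst (Adj v) (eqFin-sound {u = parent v} {v = w} (∧-elimʳ {not (eqFin v r)} c)) (parent-adj (nonRoot-sound (∧-elimˡ c))))
        (λ c1 c2 → let (wn , e1) = isChild-elim c1 in
                   parent-asym wn (nonRoot-sound (∧-elimˡ c2)) e1 (eqFin-sound {u = parent v} {v = w} (∧-elimʳ {not (eqFin v r)} c2))))))
    where
    isParentOf : Fin n → Bool
    isParentOf w = not (eqFin v r) ∧ eqFin (parent v) w
    parentCount : ∀ b → eqFin v r ≡ b → ind (not b) ≤ sumFin (λ w → ind (isParentOf w))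
    parentCount true _ = z≤n
    parentCount false e = sumFin-ind≥1 isParentOf (parent v) (∧-intro (not-intro e) (eqFin-refl (parent v)))

  shift : Fin n → ℕ
  shift x = if eqFin (parent x) r then 0 else 2

  childGroup : Fin n → ℕ
  childGroup x = (rank x + shift x) / 3

  childLeg : Fin n → ℕ
  childLeg x = (rank x + shift x) % 3

  continues : Fin n → Bool
  continues x = not (eqFin (parent x) r) ∧ (rank x ≡ᵇ 0)

  continues-parent-nonroot : ∀ {x} → continues x ≡ true → parent x ≢ r
  continues-parent-nonroot {x} c e = true≢false (∧-elimˡ {not (eqFin (parent x) r)} c) (cong not (eqFin-complete e))

  shift≤2 : ∀ x → shift x ≤ 2
  shift≤2 x with eqFin (parent x) r
  ... | true = z≤n
  ... | false = NP.≤-refl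

  shift-siblings : ∀ {x y} → parent x ≡ parent y → shift x ≡ shift y
  shift-siblings e = cong (λ p → if eqFin p r then 0 else 2) e

  group-leg-injective : ∀ {x y} → parent x ≡ parent y → childGroup x ≡ childGroup y → childLeg x ≡ childLeg y → rank x ≡ rank y
  group-leg-injective {x} {y} e g p = NP.+-cancelʳ-≡ (shift x) (rank x) (rank y) (begin
    rank x + shift x                           ≡⟨ m≡m%n+[m/n]*n (rank x + shift x) 3 ⟩
    childLeg x + childGroup x * 3              ≡⟨ cong₂ (λ a b → a + b * 3) p g ⟩
    childLeg y + childGroup y * 3              ≡⟨ sym (m≡m%n+[m/n]*n (rank y + shift y) 3) ⟩
    rank y + shift y                           ≡⟨ cong (rank y +_) (sym (shift-siblings e)) ⟩
    rank y + shift x                           ∎)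
    where open ≡-Reasoning

  record Place : Set where
    constructor mkPlace
    field
      topOf   : Fin n
      groupOf : ℕ
      legOf   : ℕ
      indexOf : ℕ
  open Place public

  startPlace : Fin n → Place
  startPlace x = mkPlace (parent x) (childGroup x) (childLeg x) 1

  nextPlace : Place → Place
  nextPlace p = record p { indexOf = suc (indexOf p) }

  placeBelow : ℕ → Fin n → Place
  placeBelow zero x = startPlace x
  placeBelow (suc k) x = if continues x then nextPlace (placeBelow k (parent x)) else startPlace x

  place : Fin n → Place
  place x = placeBelow (depth x) x

  place-nonroot : ∀ {x} → x ≢ r → place x ≡ (if continues x then nextPlace (place (parent x)) else startPlace x)
  place-nonroot {x} ne = cong (λ j → placeBelow j x) (depth-parent ne)

  place-continues : ∀ {x} → x ≢ r → continues x ≡ true → place x ≡ nextPlace (place (parent x))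
  place-continues {x} ne c = trans (place-nonroot ne) (cong (λ b → if b then nextPlace (place (parent x)) else startPlace x) c)

  place-starts : ∀ {x} → x ≢ r → continues x ≡ false → place x ≡ startPlace x
  place-starts {x} ne c = trans (place-nonroot ne) (cong (λ b → if b then nextPlace (place (parent x)) else startPlace x) c)

  record LegStart (x : Fin n) : Set where
    field
      start     : Fin n
      start≢r   : start ≢ r
      start-new : continues start ≡ false
      top≡      : topOf (place x) ≡ parent start
      group≡    : groupOf (place x) ≡ childGroup start
      leg≡      : legOf (place x) ≡ childLeg start
      depth≡    : depth x ≡ depth (parent start) + indexOf (place x)
      index≥1   : 1 ≤ indexOf (place x)

  legStartBelow : ∀ k x → depth x ≡ k → x ≢ r → LegStart x
  legStartBelow k x e ne with continues x in c
  ... | false = record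
    { start = x ; start≢r = ne ; start-new = c
    ; top≡ = cong topOf ps ; group≡ = cong groupOf ps ; leg≡ = cong legOf ps
    ; depth≡ = trans (depth-parent ne) (trans (NP.+-comm 1 _) (cong (λ t → depth (parent x) + indexOf t) (sym ps)))
    ; index≥1 = subst (λ t → 1 ≤ indexOf t) (sym ps) (s≤s z≤n) }
    where
    ps : place x ≡ startPlace x
    ps = place-starts ne c
  legStartBelow zero x e ne | true = ⊥-elim (ne (depth≡0⇒root e))
  legStartBelow (suc k) x e ne | true = record
    { start = start ; start≢r = start≢r ; start-new = start-new
    ; top≡ = trans (cong topOf pc) top≡ ; group≡ = trans (cong groupOf pc) group≡ ; leg≡ = trans (cong legOf pc) leg≡
    ; depth≡ = trans (depth-parent ne) (trans (cong suc depth≡)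
                 (trans (sym (NP.+-suc _ _)) (cong (λ t → depth (parent start) + indexOf t) (sym pc))))
    ; index≥1 = subst (λ t → 1 ≤ indexOf t) (sym pc) (s≤s z≤n) }
    where
    pc : place x ≡ nextPlace (place (parent x))
    pc = place-continues ne c
    open LegStart (legStartBelow k (parent x) (NP.suc-injective (trans (sym (depth-parent ne)) e)) (continues-parent-nonroot c))

  legStart : ∀ x → x ≢ r → LegStart x
  legStart x ne = legStartBelow (depth x) x refl ne

  index-continues : ∀ {x} → x ≢ r → continues x ≡ true → 2 ≤ indexOf (place x)
  index-continues {x} ne c = subst (λ i → 2 ≤ indexOf i) (sym (place-continues ne c))
    (s≤s (LegStart.index≥1 (legStart (parent x) (continues-parent-nonroot c))))

  depth-below-top : ∀ {x} → x ≢ r → depth x ≡ depth (topOf (place x)) + indexOf (place x)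
  depth-below-top {x} ne = trans depth≡ (cong (λ z → depth z + indexOf (place x)) (sym top≡))
    where open LegStart (legStart x ne)

  leg<3 : ∀ {x} → x ≢ r → legOf (place x) < 3
  leg<3 {x} ne = subst (_< 3) (sym leg≡) (m%n<n (rank start + shift start) 3)
    where open LegStart (legStart x ne)

  base : ℕ
  base = suc (suc (suc n))

  owner : Fin n → ℕ
  owner x = F.toℕ (topOf (place x)) * base + groupOf (place x)

  childGroup<base : ∀ x → childGroup x < base
  childGroup<base x = s≤s (NP.≤-trans (m/n≤m (rank x + shift x) 3)
    (NP.≤-trans (NP.+-mono-≤ (sumFin-ind≤size _) (shift≤2 x)) (NP.≤-reflexive (NP.+-comm n 2))))

  group<base : ∀ {x} → x ≢ r → groupOf (place x) < base
  group<base {x} ne = subst (_< base) (sym (LegStart.group≡ (legStart x ne))) (childGroup<base _)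

  code-% : ∀ t g → g < base → (t * base + g) % base ≡ g
  code-% t g lt = trans (cong (_% base) (NP.+-comm (t * base) g)) (trans ([m+kn]%n≡m%n g t base) (m<n⇒m%n≡m lt))

  code-/ : ∀ t g → g < base → (t * base + g) / base ≡ t
  code-/ t g lt = NP.*-cancelʳ-≡ _ _ base (NP.+-cancelˡ-≡ g _ _
    (trans (cong (_+ ((t * base + g) / base) * base) (sym (code-% t g lt)))
      (trans (sym (m≡m%n+[m/n]*n (t * base + g) base)) (NP.+-comm (t * base) g))))

  owner-/ : ∀ x → x ≢ r → owner x / base ≡ F.toℕ (topOf (place x))
  owner-/ x ne = code-/ (F.toℕ (topOf (place x))) _ (group<base ne)

  owner-% : ∀ x → x ≢ r → owner x % base ≡ groupOf (place x)
  owner-% x ne = code-% (F.toℕ (topOf (place x))) _ (group<base ne)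

  owner-injective : ∀ {x y} → x ≢ r → y ≢ r → owner x ≡ owner y →
    (topOf (place x) ≡ topOf (place y)) × (groupOf (place x) ≡ groupOf (place y))
  owner-injective {x} {y} nx ny e =
    FP.toℕ-injective (trans (sym (owner-/ x nx)) (trans (cong (_/ base) e) (owner-/ y ny))) ,
    trans (sym (owner-% x nx)) (trans (cong (_% base) e) (owner-% y ny))

  isTopOf : ℕ → Fin n → Bool
  isTopOf π v = F.toℕ v ≡ᵇ π / base

  inLeg : ℕ → Fin n → Bool
  inLeg π v = not (eqFin v r) ∧ (owner v ≡ᵇ π)

  inPart : ℕ → Fin n → Bool
  inPart π v = isTopOf π v ∨ inLeg π v

  inLeg-elim : ∀ {π x} → inLeg π x ≡ true → (x ≢ r) × (owner x ≡ π)
  inLeg-elim {π} {x} p = nonRoot-sound (∧-elimˡ p) , ≡ᵇ-sound (∧-elimʳ {not (eqFin x r)} p)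

  inLeg-intro : ∀ {π x} → x ≢ r → owner x ≡ π → inLeg π x ≡ true
  inLeg-intro {π} {x} ne e = ∧-intro (nonRoot-true ne) (subst (λ z → (owner x ≡ᵇ z) ≡ true) e (≡ᵇ-refl (owner x)))

  leg-inPart : ∀ {π u} → inLeg π u ≡ true → inPart π u ≡ true
  leg-inPart {π} {u} o = ∨-introʳ {isTopOf π u} o

  top-unique : ∀ {π x v} → inLeg π x ≡ true → isTopOf π v ≡ true → v ≡ topOf (place x)
  top-unique {π} {x} {v} o t = let (ne , e) = inLeg-elim o in
    FP.toℕ-injective (trans (≡ᵇ-sound {F.toℕ v} {π / base} t) (trans (cong (_/ base) (sym e)) (owner-/ x ne)))

  top-of-leg : ∀ {π x} → inLeg π x ≡ true → isTopOf π (topOf (place x)) ≡ true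
  top-of-leg {π} {x} o = let (ne , e) = inLeg-elim o in
    subst (λ z → (F.toℕ (topOf (place x)) ≡ᵇ z) ≡ true) (trans (sym (owner-/ x ne)) (cong (_/ base) e)) (≡ᵇ-refl (F.toℕ (topOf (place x))))

  leg-not-top : ∀ {π x} → inLeg π x ≡ true → isTopOf π x ≡ true → ⊥
  leg-not-top {π} {x} o t = NP.<-irrefl refl (subst (λ z → depth z < depth x) (sym (top-unique o t)) top-above)
    where
    ne : x ≢ r
    ne = proj₁ (inLeg-elim o)
    top-above : depth (topOf (place x)) < depth x
    top-above = subst (_≤ depth x) (NP.+-comm (depth (topOf (place x))) 1)
      (subst (depth (topOf (place x)) + 1 ≤_) (sym (depth-below-top ne))
        (NP.+-monoʳ-≤ (depth (topOf (place x))) (LegStart.index≥1 (legStart x ne))))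

  inLeg-parent : ∀ {π x} → inLeg π x ≡ true →
    ((continues x ≡ true) × (inLeg π (parent x) ≡ true) × (place x ≡ nextPlace (place (parent x))))
    ⊎ ((continues x ≡ false) × (isTopOf π (parent x) ≡ true) × (place x ≡ startPlace x))
  inLeg-parent {π} {x} o with continues x in c
  ... | true = let (ne , e) = inLeg-elim o ; pc = place-continues ne c in
     inj₁ (refl , inLeg-intro (continues-parent-nonroot c) (trans (cong (λ p → F.toℕ (topOf p) * base + groupOf p) (sym pc)) e) , pc)
  ... | false = let (ne , e) = inLeg-elim o ; ps = place-starts ne c in
     inj₂ (refl , subst (λ z → isTopOf π z ≡ true) (cong topOf ps) (top-of-leg o) , ps)

  parent-inPart : ∀ {π u} → inLeg π u ≡ true → inPart π (parent u) ≡ true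
  parent-inPart {π} {u} o with inLeg-parent o
  ... | inj₁ (_ , op , _) = ∨-introʳ {isTopOf π (parent u)} op
  ... | inj₂ (_ , tp , _) = ∨-introˡ tp

  -- Within one spider, a vertex is determined by its leg and index: induct
  -- on the index, the two leg starts being siblings of equal rank.
  leg-injectiveBelow : ∀ k {π x y} → indexOf (place x) ≡ k → inLeg π x ≡ true → inLeg π y ≡ true →
    legOf (place x) ≡ legOf (place y) → indexOf (place x) ≡ indexOf (place y) → x ≡ y
  leg-injectiveBelow k {π} {x} {y} ek ox oy el ei with inLeg-parent ox | inLeg-parent oy
  ... | inj₂ (cx , tx , px) | inj₂ (cy , ty , py) =
    let (nx , ex) = inLeg-elim ox ; (ny , ey) = inLeg-elim oy
        (et , eg) = owner-injective nx ny (trans ex (sym ey))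
        ep = trans (sym (cong topOf px)) (trans et (cong topOf py))
    in rank-injective nx ny ep (group-leg-injective ep (trans (sym (cong groupOf px)) (trans eg (cong groupOf py)))
                                                       (trans (sym (cong legOf px)) (trans el (cong legOf py))))
  ... | inj₁ (cx , _ , _) | inj₂ (cy , _ , py) =
    ⊥-elim (NP.<-irrefl refl (NP.≤-trans (index-continues (proj₁ (inLeg-elim ox)) cx) (NP.≤-reflexive (trans ei (cong indexOf py)))))
  ... | inj₂ (cx , _ , px) | inj₁ (cy , _ , _) =
    ⊥-elim (NP.<-irrefl refl (NP.≤-trans (index-continues (proj₁ (inLeg-elim oy)) cy) (NP.≤-reflexive (trans (sym ei) (cong indexOf px)))))
  ... | inj₁ (cx , opx , px) | inj₁ (cy , opy , py) with k
  ...   | zero = ⊥-elim (2≰0 (subst (2 ≤_) ek (index-continues (proj₁ (inLeg-elim ox)) cx)))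
    where
    2≰0 : 2 ≤ 0 → ⊥
    2≰0 ()
  ...   | suc k' =
    let nx = proj₁ (inLeg-elim ox) ; ny = proj₁ (inLeg-elim oy)
        pe = leg-injectiveBelow k' {π} {parent x} {parent y} (NP.suc-injective (trans (sym (cong indexOf px)) ek)) opx opy
               (trans (sym (cong legOf px)) (trans el (cong legOf py)))
               (NP.suc-injective (trans (sym (cong indexOf px)) (trans ei (cong indexOf py))))
    in rank-injective nx ny pe (trans (≡ᵇ-sound (∧-elimʳ {not (eqFin (parent x) r)} cx))
                                      (sym (≡ᵇ-sound (∧-elimʳ {not (eqFin (parent y) r)} cy))))

  leg-injective : ∀ {π x y} → inLeg π x ≡ true → inLeg π y ≡ true →
    legOf (place x) ≡ legOf (place y) → indexOf (place x) ≡ indexOf (place y) → x ≡ y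
  leg-injective {x = x} = leg-injectiveBelow (indexOf (place x)) refl

  childEdgeIn : ℕ → Fin n → Fin n → Bool
  childEdgeIn π u w = inLeg π u ∧ eqFin (parent u) w

  adjIn : ℕ → Fin n → Fin n → Bool
  adjIn π u w = adj TG u w ∧ (childEdgeIn π u w ∨ childEdgeIn π w u)

  adjIn-sym : ∀ π u w → adjIn π u w ≡ true → adjIn π w u ≡ true
  adjIn-sym π u w p = ∧-intro (Adj-sym (∧-elimˡ p)) (∨-swap {childEdgeIn π u w} (∧-elimʳ {adj TG u w} p))

  adjIn-irrefl : ∀ π u → adjIn π u u ≡ false
  adjIn-irrefl π u rewrite Graph.irrefl TG u = refl

  adjIn-elim : ∀ {π u w} → adjIn π u w ≡ true →
    ((inLeg π u ≡ true) × (parent u ≡ w)) ⊎ ((inLeg π w ≡ true) × (parent w ≡ u))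
  adjIn-elim {π} {u} {w} p with ∨-elim {childEdgeIn π u w} (∧-elimʳ {adj TG u w} p)
  ... | inj₁ q = inj₁ (childEdge q)
    where childEdge : childEdgeIn π u w ≡ true → (inLeg π u ≡ true) × (parent u ≡ w)
          childEdge q = ∧-elimˡ q , eqFin-sound (∧-elimʳ {inLeg π u} q)
  ... | inj₂ q = inj₂ (∧-elimˡ q , eqFin-sound (∧-elimʳ {inLeg π w} q))

  adjIn-inPart : ∀ π u w → adjIn π u w ≡ true → (inPart π u ≡ true) × (inPart π w ≡ true)
  adjIn-inPart π u w p with adjIn-elim {π} p
  ... | inj₁ (o , e) = leg-inPart o , subst (λ z → inPart π z ≡ true) e (parent-inPart o)
  ... | inj₂ (o , e) = subst (λ z → inPart π z ≡ true) e (parent-inPart o) , leg-inPart o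

  adjIn-parent : ∀ {π u} → inLeg π u ≡ true → adjIn π u (parent u) ≡ true
  adjIn-parent {π} {u} o = ∧-intro (parent-adj (proj₁ (inLeg-elim o))) (∨-introˡ (∧-intro o (eqFin-refl (parent u))))

  adjIn-up : ∀ {π x y} → inLeg π x ≡ true → parent x ≡ y → adjIn π x y ≡ true
  adjIn-up {π} {x} o e = subst (λ z → adjIn π x z ≡ true) e (adjIn-parent o)

  adjIn-down : ∀ {π x y} → inLeg π y ≡ true → parent y ≡ x → adjIn π x y ≡ true
  adjIn-down {π} {x} {y} o e = adjIn-sym π y x (adjIn-up o e)

  spider : ℕ → Graph n
  spider π = record { vert = inPart π ; adj = adjIn π ; sym = adjIn-sym π ; irrefl = adjIn-irrefl π ; adjV = adjIn-inPart π }

  Occupied : ℕ → Set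
  Occupied π = ∃[ x ] (x ≢ r) × (owner x ≡ π)

  -- An occupied spider is a tree: every vertex walks up to the top, and a
  -- cycle in it would be a cycle in TG.
  module SpiderTree (π : ℕ) (occ : Occupied π) where

    x₀ : Fin n
    x₀ = proj₁ occ

    x₀-inLeg : inLeg π x₀ ≡ true
    x₀-inLeg = inLeg-intro (proj₁ (proj₂ occ)) (proj₂ (proj₂ occ))

    topVertex : Fin n
    topVertex = topOf (place x₀)

    top-inPart : inPart π topVertex ≡ true
    top-inPart = ∨-introˡ (top-of-leg x₀-inLeg)

    top-unique′ : ∀ {x y} → isTopOf π x ≡ true → isTopOf π y ≡ true → x ≡ y
    top-unique′ tx ty = trans (top-unique x₀-inLeg tx) (sym (top-unique x₀-inLeg ty))

    toTopBelow : ∀ k u → depth u ≡ k → inPart π u ≡ true → Walk (spider π) u topVertex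
    toTopBelow k u e p with ∨-elim {isTopOf π u} p
    ... | inj₁ t = subst (λ z → Walk (spider π) u z) (top-unique x₀-inLeg t) here
    toTopBelow zero u e p | inj₂ o = ⊥-elim (proj₁ (inLeg-elim o) (depth≡0⇒root e))
    toTopBelow (suc k) u e p | inj₂ o =
      step (adjIn-parent o) (toTopBelow k (parent u) (NP.suc-injective (trans (sym (depth-parent (proj₁ (inLeg-elim o)))) e)) (parent-inPart o))

    spider-connected : Connected (spider π)
    spider-connected u w pu pw = walk-++ (toTop u pu) (walk-reverse (toTop w pw))
      where
      toTop : ∀ u → inPart π u ≡ true → Walk (spider π) u topVertex
      toTop u = toTopBelow (depth u) u refl

    chain-spider⇒tree : ∀ xs → Chain (spider π) xs → Chain TG xs
    chain-spider⇒tree [] c = tt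
    chain-spider⇒tree (x ∷ []) c = tt
    chain-spider⇒tree (x ∷ y ∷ xs) (a , c) = ∧-elimˡ a , chain-spider⇒tree (y ∷ xs) c

    spider-isTree : IsTree (spider π)
    spider-isTree = (x₀ , leg-inPart x₀-inLeg) , spider-connected ,
                    (λ x xs (l , u , c) → acyc x xs (l , u , chain-spider⇒tree _ c))

-- Drawing a spider: roles and their bars
--
-- A vertex of a spider has a role: the top, or the i-th vertex (i ≥ 1) of
-- leg l < 3.  Relative to a horizontal offset, the top is drawn at column 6
-- and height 0; legs 0 and 1 rise in columns 12 and 0 (heights 1, 2, …),
-- leg 2 descends in column 6 (heights -1, -2, …).  So consecutive vertices
-- of a leg are stacked in one column, the first vertex of each leg overlaps
-- the top by four columns, and legs 0 and 1 overlap neither each other nor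
-- anything below height 0.  Here we show, for any downward closed set of
-- drawn roles, that two bars see each other exactly when one role is the
-- parent of the other, and that distinct roles get disjoint bars.

neg : ℕ → ℤ
neg i = Z.- (int i)

+<+⇒< : ∀ {i j} → int i Z.< int j → i < j
+<+⇒< = ZP.drop‿+<+

neg<neg⇒> : ∀ {i j} → neg i Z.< neg j → j < i
neg<neg⇒> p = +<+⇒< (ZP.neg-cancel-< p)

>⇒neg<neg : ∀ {i j} → j < i → neg i Z.< neg j
>⇒neg<neg p = ZP.neg-mono-< (Z.+<+ p)

+≮neg : ∀ {i j} → int i Z.< neg j → ⊥
+≮neg {i} {zero} (Z.+<+ ())
+≮neg {i} {suc j} ()

neg<+ : ∀ {i j} → 1 ≤ i → neg i Z.< int j
neg<+ {suc i} _ = Z.-<+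

suc-neg : ∀ i → Z.suc (neg (suc i)) ≡ neg i
suc-neg zero = refl
suc-neg (suc i) = refl

+≢neg : ∀ {i j} → 1 ≤ j → int i ≢ neg j
+≢neg {i} {suc j} _ ()

data Role : Set where
  top : Role
  leg : ℕ → ℕ → Role

ValidRole : Role → Set
ValidRole top = ⊤
ValidRole (leg l i) = (l < 3) × (1 ≤ i)

data RoleEdge : Role → Role → Set where
  first : ∀ l → RoleEdge (leg l 1) top
  next  : ∀ l i → RoleEdge (leg l (suc (suc i))) (leg l (suc i))

legColumn : ℕ → ℕ
legColumn zero = 12
legColumn (suc zero) = 0
legColumn (suc (suc _)) = 6

legGoesUp : ℕ → Bool
legGoesUp zero = true
legGoesUp (suc zero) = true
legGoesUp (suc (suc _)) = false

roleX : Role → ℕ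
roleX top = 6
roleX (leg l i) = legColumn l

roleY : Role → ℤ
roleY top = int 0
roleY (leg l i) = if legGoesUp l then int i else neg i

roleX≤12 : ∀ ρ → roleX ρ ≤ 12
roleX≤12 top = NP.m≤m+n 6 6
roleX≤12 (leg zero i) = NP.≤-refl
roleX≤12 (leg (suc zero) i) = z≤n
roleX≤12 (leg (suc (suc l)) i) = NP.m≤m+n 6 6

roleBar : ℕ → Role → Bar
roleBar offset ρ = gridBar (offset + roleX ρ) (roleY ρ)

3≰leg : ∀ {k} → suc (suc (suc k)) < 3 → ⊥
3≰leg (s≤s (s≤s (s≤s ())))

Window : ℕ → ℕ → Set
Window Xa Xb = Σ ℕ λ P → Σ ℕ λ Q → (P < Q) × (Xa ≤ P) × (Q ≤ Xa + 10) × (Xb ≤ P) × (Q ≤ Xb + 10)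

window : ∀ offset a b → a ≤ b → b < a + 10 → Window (offset + a) (offset + b)
window offset a b ab ba = offset + b , offset + a + 10 ,
  subst (offset + b <_) (sym (NP.+-assoc offset a 10)) (NP.+-monoʳ-< offset ba) ,
  NP.+-monoʳ-≤ offset ab , NP.≤-refl , NP.≤-refl , NP.+-monoˡ-≤ 10 (NP.+-monoʳ-≤ offset ab)

window-sym : ∀ {Xa Xb} → Window Xa Xb → Window Xb Xa
window-sym (P , Q , a , b , c , d , e) = P , Q , a , d , e , b , c

window-same : ∀ X → Window X X
window-same X = X , X + 10 , NP.m<m+n X (s≤s z≤n) , NP.≤-refl , NP.≤-refl , NP.≤-refl , NP.≤-refl

see-sym : ∀ {m} {R : BarAssignment m} {a b} → SeeEachOther R a b → SeeEachOther R b a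
see-sym (inj₁ x) = inj₂ x
see-sym (inj₂ y) = inj₁ y

disjoint-sym : ∀ {a b} → Disjoint a b → Disjoint b a
disjoint-sym (inj₁ ne) = inj₁ (λ e → ne (sym e))
disjoint-sym (inj₂ (inj₁ x)) = inj₂ (inj₂ x)
disjoint-sym (inj₂ (inj₂ y)) = inj₂ (inj₁ y)

module _ (offset : ℕ) where

  differentY : ∀ ρa ρb → roleY ρa ≢ roleY ρb → Disjoint (roleBar offset ρa) (roleBar offset ρb)
  differentY ρa ρb ne = grid-disjoint {offset + roleX ρa} {roleY ρa} {offset + roleX ρb} {roleY ρb} (inj₁ ne)

  disjoint-upLegs : ∀ {i j} → Disjoint (roleBar offset (leg 1 i)) (roleBar offset (leg 0 j))
  disjoint-upLegs {i} {j} = grid-disjoint {offset + 0} {int i} {offset + 12} {int j}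
    (inj₂ (inj₁ (subst (_< offset + 12) (sym (NP.+-assoc offset 0 10)) (NP.+-monoʳ-< offset (NP.m≤m+n 11 1)))))

  disjoint-top-leg : ∀ {l j} → ValidRole (leg l j) → Disjoint (roleBar offset top) (roleBar offset (leg l j))
  disjoint-top-leg {zero} {suc j} _ = differentY top (leg 0 (suc j)) (λ ())
  disjoint-top-leg {suc zero} {suc j} _ = differentY top (leg 1 (suc j)) (λ ())
  disjoint-top-leg {suc (suc l)} {suc j} _ = differentY top (leg (suc (suc l)) (suc j)) (λ ())

  disjoint-legs : ∀ {l i l' j} → ValidRole (leg l i) → ValidRole (leg l' j) → leg l i ≢ leg l' j →
    Disjoint (roleBar offset (leg l i)) (roleBar offset (leg l' j))
  disjoint-legs {zero} {i} {zero} {j} _ _ ne =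
    differentY (leg 0 i) (leg 0 j) (λ e → ne (cong (leg 0) (ZP.+-injective e)))
  disjoint-legs {suc zero} {i} {suc zero} {j} _ _ ne =
    differentY (leg 1 i) (leg 1 j) (λ e → ne (cong (leg 1) (ZP.+-injective e)))
  disjoint-legs {suc (suc zero)} {i} {suc (suc zero)} {j} _ _ ne =
    differentY (leg 2 i) (leg 2 j) (λ e → ne (cong (leg 2) (ZP.+-injective (ZP.neg-injective e))))
  disjoint-legs {zero} {l' = suc zero} _ _ _ = disjoint-sym disjoint-upLegs
  disjoint-legs {suc zero} {l' = zero} _ _ _ = disjoint-upLegs
  disjoint-legs {zero} {i} {suc (suc l')} {j} _ (_ , j≥1) _ = differentY (leg 0 i) (leg (suc (suc l')) j) (+≢neg j≥1)
  disjoint-legs {suc zero} {i} {suc (suc l')} {j} _ (_ , j≥1) _ = differentY (leg 1 i) (leg (suc (suc l')) j) (+≢neg j≥1)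
  disjoint-legs {suc (suc l)} {i} {zero} {j} (_ , i≥1) _ _ =
    differentY (leg (suc (suc l)) i) (leg 0 j) (λ e → +≢neg i≥1 (sym e))
  disjoint-legs {suc (suc l)} {i} {suc zero} {j} (_ , i≥1) _ _ =
    differentY (leg (suc (suc l)) i) (leg 1 j) (λ e → +≢neg i≥1 (sym e))
  disjoint-legs {suc (suc (suc l))} (l<3 , _) _ _ = ⊥-elim (3≰leg l<3)
  disjoint-legs {suc (suc zero)} {l' = suc (suc (suc l'))} _ (l'<3 , _) _ = ⊥-elim (3≰leg l'<3)

  disjoint-roles : ∀ {ρ ρ'} → ValidRole ρ → ValidRole ρ' → ρ ≢ ρ' → Disjoint (roleBar offset ρ) (roleBar offset ρ')
  disjoint-roles {top} {top} _ _ ne = ⊥-elim (ne refl)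
  disjoint-roles {top} {leg l j} _ v' _ = disjoint-top-leg v'
  disjoint-roles {leg l i} {top} v _ _ = disjoint-sym (disjoint-top-leg v)
  disjoint-roles {leg l i} {leg l' j} v v' ne = disjoint-legs v v' ne

module RoleVisibility {m : ℕ} (R : BarAssignment m) (intHeights : ∀ c → ∃[ Y ] by (barAt R c) ≡ toℚ Y)
                      (offset : ℕ) where

  window-seesUp : ∀ {ρa ρb} → Window (offset + roleX ρa) (offset + roleX ρb) → roleY ρb ≡ Z.suc (roleY ρa) →
    SeesUp R (roleBar offset ρa) (roleBar offset ρb)
  window-seesUp (P , Q , a , b , c , d , e) eq = grid-seesUp R intHeights P Q a b c d e eq

  edge-sees : ∀ {ρ ρ'} → RoleEdge ρ ρ' → SeeEachOther R (roleBar offset ρ) (roleBar offset ρ')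
  edge-sees (first zero) =
    inj₂ (window-seesUp {top} {leg 0 1} (window offset 6 12 (NP.m≤m+n 6 6) (s≤s (NP.m≤m+n 12 3))) refl)
  edge-sees (first (suc zero)) =
    inj₂ (window-seesUp {top} {leg 1 1} (window-sym (window offset 0 6 z≤n (s≤s (NP.m≤m+n 6 3)))) refl)
  edge-sees (first (suc (suc l))) = inj₁ (window-seesUp {leg (suc (suc l)) 1} {top} (window-same _) refl)
  edge-sees (next zero i) = inj₂ (window-seesUp {leg 0 (suc i)} {leg 0 (suc (suc i))} (window-same _) refl)
  edge-sees (next (suc zero) i) = inj₂ (window-seesUp {leg 1 (suc i)} {leg 1 (suc (suc i))} (window-same _) refl)
  edge-sees (next (suc (suc l)) i) =
    inj₁ (window-seesUp {leg (suc (suc l)) (suc (suc i))} {leg (suc (suc l)) (suc i)} (window-same _) (sym (suc-neg (suc i))))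

  seesUp-y : ∀ {ρa ρb} → SeesUp R (roleBar offset ρa) (roleBar offset ρb) → roleY ρa Z.< roleY ρb
  seesUp-y {ρa} {ρb} s = proj₂ (proj₂ (seesUp-overlap R {offset + roleX ρa} {roleY ρa} {offset + roleX ρb} {roleY ρb} s))

  seesUp-x₁ : ∀ {ρa ρb} → SeesUp R (roleBar offset ρa) (roleBar offset ρb) → roleX ρb < roleX ρa + 10
  seesUp-x₁ {ρa} {ρb} s = NP.+-cancelˡ-< offset _ _ (subst (offset + roleX ρb <_) (NP.+-assoc offset (roleX ρa) 10)
    (proj₁ (seesUp-overlap R {offset + roleX ρa} {roleY ρa} {offset + roleX ρb} {roleY ρb} s)))

  seesUp-x₂ : ∀ {ρa ρb} → SeesUp R (roleBar offset ρa) (roleBar offset ρb) → roleX ρa < roleX ρb + 10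
  seesUp-x₂ {ρa} {ρb} s = NP.+-cancelˡ-< offset _ _ (subst (offset + roleX ρa <_) (NP.+-assoc offset (roleX ρb) 10)
    (proj₁ (proj₂ (seesUp-overlap R {offset + roleX ρa} {roleY ρa} {offset + roleX ρb} {roleY ρb} s))))

  -- With a downward closed set of drawn roles, all present in R, visibility
  -- only happens along role edges: any other pair is blocked by a drawn bar.
  module _ (Drawn : Role → Set) (drawn-top : Drawn top)
           (drawn-up : ∀ {l i} → Drawn (leg l (suc (suc i))) → Drawn (leg l (suc i)))
           (drawn-bar : ∀ {ρ} → Drawn ρ → Σ (Pos R) λ c → barAt R c ≡ roleBar offset ρ) where

    drawn-above : ∀ {l} k d → Drawn (leg l (k + d)) → 1 ≤ k → Drawn (leg l k)
    drawn-above {l} k zero dr _ = subst (λ t → Drawn (leg l t)) (NP.+-identityʳ k) dr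
    drawn-above {l} (suc k) (suc d) dr k≥1 =
      drawn-above (suc k) d (drawn-up (subst (λ t → Drawn (leg l t)) (NP.+-suc (suc k) d) dr)) k≥1

    blocked : ∀ {ρu ρw ρz} → SeesUp R (roleBar offset ρu) (roleBar offset ρw) → Drawn ρz →
      (roleX ρz ≡ roleX ρu ⊎ roleX ρz ≡ roleX ρw) → roleY ρu Z.< roleY ρz → roleY ρz Z.< roleY ρw → ⊥
    blocked s dz xc y1 y2 = seesUp-unblocked R s (proj₁ (drawn-bar dz)) (proj₂ (drawn-bar dz)) (shifted xc) y1 y2
      where
      shifted : ∀ {a b c} → (a ≡ b ⊎ a ≡ c) → (offset + a ≡ offset + b ⊎ offset + a ≡ offset + c)
      shifted (inj₁ e) = inj₁ (cong (offset +_) e)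
      shifted (inj₂ e) = inj₂ (cong (offset +_) e)

    UpLeg : ℕ → Set
    UpLeg l = ∀ k → roleY (leg l k) ≡ int k

    top→upLeg : ∀ {l} j → UpLeg l → 1 ≤ j → Drawn (leg l j) →
      SeesUp R (roleBar offset top) (roleBar offset (leg l j)) → RoleEdge (leg l j) top
    top→upLeg (suc zero) up _ _ _ = first _
    top→upLeg {l} (suc (suc j)) up _ dj s = ⊥-elim (blocked {top} {leg l (suc (suc j))} s (drawn-above 1 (suc j) dj (s≤s z≤n))
      (inj₂ refl) (subst (int 0 Z.<_) (sym (up 1)) (Z.+<+ (s≤s z≤n)))
      (subst₂ Z._<_ (sym (up 1)) (sym (up (suc (suc j)))) (Z.+<+ (s≤s (s≤s z≤n)))))

    downLeg→top : ∀ {l} i → 1 ≤ i → Drawn (leg (suc (suc l)) i) →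
      SeesUp R (roleBar offset (leg (suc (suc l)) i)) (roleBar offset top) → RoleEdge (leg (suc (suc l)) i) top
    downLeg→top (suc zero) _ _ _ = first _
    downLeg→top {l} (suc (suc i)) _ di s = ⊥-elim (blocked {leg (suc (suc l)) (suc (suc i))} {top} s
      (drawn-above 1 (suc i) di (s≤s z≤n)) (inj₁ refl) (>⇒neg<neg (s≤s (s≤s z≤n))) (neg<+ (s≤s z≤n)))

    upLeg→upLeg : ∀ {l} i d → UpLeg l → 1 ≤ i → Drawn (leg l (suc i + d)) →
      SeesUp R (roleBar offset (leg l i)) (roleBar offset (leg l (suc i + d))) → RoleEdge (leg l (suc i + d)) (leg l i)
    upLeg→upLeg {l} (suc i) zero up _ _ _ =
      subst (λ t → RoleEdge (leg l (suc t)) (leg l (suc i))) (sym (NP.+-identityʳ (suc i))) (next l i)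
    upLeg→upLeg {l} (suc i) (suc d) up _ dj s = ⊥-elim (blocked {leg l (suc i)} {leg l (suc (suc i) + suc d)} s
      (drawn-above (suc (suc i)) (suc d) dj (s≤s z≤n)) (inj₂ refl)
      (subst₂ Z._<_ (sym (up (suc i))) (sym (up (suc (suc i)))) (Z.+<+ NP.≤-refl))
      (subst₂ Z._<_ (sym (up (suc (suc i)))) (sym (up (suc (suc i) + suc d))) (Z.+<+ (NP.m<m+n (suc (suc i)) (s≤s z≤n)))))

    downLeg→downLeg : ∀ j d → 1 ≤ j → Drawn (leg 2 (suc j + d)) →
      SeesUp R (roleBar offset (leg 2 (suc j + d))) (roleBar offset (leg 2 j)) → RoleEdge (leg 2 (suc j + d)) (leg 2 j)
    downLeg→downLeg (suc j) zero _ _ _ =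
      subst (λ t → RoleEdge (leg 2 (suc t)) (leg 2 (suc j))) (sym (NP.+-identityʳ (suc j))) (next 2 j)
    downLeg→downLeg (suc j) (suc d) _ di s = ⊥-elim (blocked {leg 2 (suc (suc j) + suc d)} {leg 2 (suc j)} s
      (drawn-above (suc (suc j)) (suc d) di (s≤s z≤n)) (inj₁ refl)
      (>⇒neg<neg (NP.m<m+n (suc (suc j)) (s≤s z≤n))) (>⇒neg<neg NP.≤-refl))

    split< : ∀ {i j} → i < j → j ≡ suc i + (j ∸ suc i)
    split< i<j = sym (NP.m+[n∸m]≡n i<j)

    upLeg-sees : ∀ {l i j} → UpLeg l → 1 ≤ i → Drawn (leg l j) →
      SeesUp R (roleBar offset (leg l i)) (roleBar offset (leg l j)) → RoleEdge (leg l j) (leg l i)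
    upLeg-sees {l} {i} {j} up i≥1 dj s =
      subst (λ t → RoleEdge (leg l t) (leg l i)) (sym eq) (upLeg→upLeg i (j ∸ suc i) up i≥1
        (subst (λ t → Drawn (leg l t)) eq dj) (subst (λ t → SeesUp R (roleBar offset (leg l i)) (roleBar offset (leg l t))) eq s))
      where
      eq : j ≡ suc i + (j ∸ suc i)
      eq = split< (+<+⇒< (subst₂ Z._<_ (up i) (up j) (seesUp-y s)))

    downLeg-sees : ∀ {i j} → 1 ≤ j → Drawn (leg 2 i) →
      SeesUp R (roleBar offset (leg 2 i)) (roleBar offset (leg 2 j)) → RoleEdge (leg 2 i) (leg 2 j)
    downLeg-sees {i} {j} j≥1 di s =
      subst (λ t → RoleEdge (leg 2 t) (leg 2 j)) (sym eq) (downLeg→downLeg j (i ∸ suc j) j≥1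
        (subst (λ t → Drawn (leg 2 t)) eq di) (subst (λ t → SeesUp R (roleBar offset (leg 2 t)) (roleBar offset (leg 2 j))) eq s))
      where
      eq : i ≡ suc j + (i ∸ suc j)
      eq = split< (neg<neg⇒> (seesUp-y {leg 2 i} {leg 2 j} s))

    sees⇒edge : ∀ {ρa ρb} → ValidRole ρa → ValidRole ρb → Drawn ρa → Drawn ρb →
      SeesUp R (roleBar offset ρa) (roleBar offset ρb) → RoleEdge ρa ρb ⊎ RoleEdge ρb ρa
    sees⇒edge {top} {top} _ _ _ _ s = ⊥-elim (ZP.<-irrefl refl (seesUp-y {top} {top} s))
    sees⇒edge {top} {leg zero j} _ (_ , j≥1) _ dj s = inj₂ (top→upLeg j (λ k → refl) j≥1 dj s)
    sees⇒edge {top} {leg (suc zero) j} _ (_ , j≥1) _ dj s = inj₂ (top→upLeg j (λ k → refl) j≥1 dj s)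
    sees⇒edge {top} {leg (suc (suc l)) j} _ _ _ _ s = ⊥-elim (+≮neg (seesUp-y {top} {leg (suc (suc l)) j} s))
    sees⇒edge {leg zero i} {top} _ _ _ _ s = ⊥-elim (NP.n≮0 (+<+⇒< (seesUp-y {leg 0 i} {top} s)))
    sees⇒edge {leg (suc zero) i} {top} _ _ _ _ s = ⊥-elim (NP.n≮0 (+<+⇒< (seesUp-y {leg 1 i} {top} s)))
    sees⇒edge {leg (suc (suc l)) i} {top} (_ , i≥1) _ di _ s = inj₁ (downLeg→top i i≥1 di s)
    sees⇒edge {leg zero i} {leg zero j} (_ , i≥1) _ _ dj s = inj₂ (upLeg-sees (λ k → refl) i≥1 dj s)
    sees⇒edge {leg (suc zero) i} {leg (suc zero) j} (_ , i≥1) _ _ dj s = inj₂ (upLeg-sees (λ k → refl) i≥1 dj s)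
    sees⇒edge {leg zero i} {leg (suc zero) j} _ _ _ _ s = ⊥-elim (NP.<⇒≱ (seesUp-x₂ {leg 0 i} {leg 1 j} s) (NP.m≤m+n 10 2))
    sees⇒edge {leg (suc zero) i} {leg zero j} _ _ _ _ s = ⊥-elim (NP.<⇒≱ (seesUp-x₁ {leg 1 i} {leg 0 j} s) (NP.m≤m+n 10 2))
    sees⇒edge {leg zero i} {leg (suc (suc l')) j} _ _ _ _ s = ⊥-elim (+≮neg (seesUp-y {leg 0 i} {leg (suc (suc l')) j} s))
    sees⇒edge {leg (suc zero) i} {leg (suc (suc l')) j} _ _ _ _ s = ⊥-elim (+≮neg (seesUp-y {leg 1 i} {leg (suc (suc l')) j} s))
    sees⇒edge {leg (suc (suc l)) i} {leg zero j} (_ , i≥1) (_ , j≥1) _ _ s =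
      ⊥-elim (blocked {leg (suc (suc l)) i} {leg 0 j} s drawn-top (inj₁ refl) (neg<+ i≥1) (Z.+<+ j≥1))
    sees⇒edge {leg (suc (suc l)) i} {leg (suc zero) j} (_ , i≥1) (_ , j≥1) _ _ s =
      ⊥-elim (blocked {leg (suc (suc l)) i} {leg 1 j} s drawn-top (inj₁ refl) (neg<+ i≥1) (Z.+<+ j≥1))
    sees⇒edge {leg (suc (suc (suc l))) i} (l<3 , _) _ _ _ s = ⊥-elim (3≰leg l<3)
    sees⇒edge {leg (suc (suc zero)) i} {leg (suc (suc (suc l'))) j} _ (l'<3 , _) _ _ s = ⊥-elim (3≰leg l'<3)
    sees⇒edge {leg (suc (suc zero)) i} {leg (suc (suc zero)) j} _ (_ , j≥1) di _ s = inj₁ (downLeg-sees j≥1 di s)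

top≢leg : ∀ {l i} → top ≢ leg l i
top≢leg ()

no-edge-from-top : ∀ {ρ} → RoleEdge top ρ → ⊥
no-edge-from-top ()

leg-injectiveᴿ : ∀ {l i l' j} → leg l i ≡ leg l' j → (l ≡ l') × (i ≡ j)
leg-injectiveᴿ refl = refl , refl

roleEdge-functional : ∀ {ρ ρ' ρ''} → RoleEdge ρ ρ' → RoleEdge ρ ρ'' → ρ' ≡ ρ''
roleEdge-functional (first l) (first .l) = refl
roleEdge-functional (next l i) (next .l .i) = refl

-- Drawing the spiders of a tree
--
-- Roles are injective on a spider and its edges are exactly the
-- role edges, so the drawing of spider π is a 1-bar representation of it
-- inside any arrangement with integer heights that contains it.

module SpiderDrawing {n : ℕ} (TG : Graph n) (allV : ∀ v → vert TG v ≡ true) (tr : IsTree TG) where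
  open Spiders TG allV tr public

  role : ℕ → Fin n → Role
  role π v = if isTopOf π v then top else leg (legOf (place v)) (indexOf (place v))

  offsetOf : ℕ → ℕ
  offsetOf π = 50 * π

  barOf : ℕ → Fin n → Bar
  barOf π v = roleBar (offsetOf π) (role π v)

  role-top : ∀ {π v} → isTopOf π v ≡ true → role π v ≡ top
  role-top {π} {v} e = cong (λ b → if b then top else leg (legOf (place v)) (indexOf (place v))) e

  role-leg : ∀ {π v} → inLeg π v ≡ true → role π v ≡ leg (legOf (place v)) (indexOf (place v))
  role-leg {π} {v} o = cong (λ b → if b then top else leg (legOf (place v)) (indexOf (place v))) (¬true⇒false (leg-not-top o))

  role-valid : ∀ {π v} → inPart π v ≡ true → ValidRole (role π v)
  role-valid {π} {v} p with ∨-elim {isTopOf π v} p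
  ... | inj₁ t = subst ValidRole (sym (role-top {π} t)) tt
  ... | inj₂ o = subst ValidRole (sym (role-leg o)) (leg<3 ne , LegStart.index≥1 (legStart v ne))
    where
    ne : v ≢ r
    ne = proj₁ (inLeg-elim o)

  role-parent : ∀ {π u} → inLeg π u ≡ true → RoleEdge (role π u) (role π (parent u))
  role-parent {π} {u} o with inLeg-parent o
  ... | inj₁ (c , op , pc) = subst₂ RoleEdge (sym (trans (role-leg o) (cong (λ p → leg (legOf p) (indexOf p)) pc)))
                                             (sym (role-leg op)) (nextEdge (indexOf (place (parent u))) ≥1)
    where
    ≥1 : 1 ≤ indexOf (place (parent u))
    ≥1 = LegStart.index≥1 (legStart (parent u) (proj₁ (inLeg-elim op)))
    nextEdge : ∀ i → 1 ≤ i → RoleEdge (leg (legOf (place (parent u))) (suc i)) (leg (legOf (place (parent u))) i)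
    nextEdge (suc i) _ = next _ i
  ... | inj₂ (c , tp , ps) = subst₂ RoleEdge (sym (trans (role-leg o) (cong (λ p → leg (legOf p) (indexOf p)) ps)))
                                             (sym (role-top {π} tp)) (first (childLeg u))

  module _ (π : ℕ) (occ : Occupied π) where
    open SpiderTree π occ

    role-injective : ∀ {u w} → inPart π u ≡ true → inPart π w ≡ true → role π u ≡ role π w → u ≡ w
    role-injective {u} {w} pu pw e with ∨-elim {isTopOf π u} pu | ∨-elim {isTopOf π w} pw
    ... | inj₁ tu | inj₁ tw = top-unique′ tu tw
    ... | inj₁ tu | inj₂ ow = ⊥-elim (top≢leg (trans (sym (role-top {π} tu)) (trans e (role-leg ow))))
    ... | inj₂ ou | inj₁ tw = ⊥-elim (top≢leg (sym (trans (sym (role-leg ou)) (trans e (role-top {π} tw)))))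
    ... | inj₂ ou | inj₂ ow =
      let (el , ei) = leg-injectiveᴿ (trans (sym (role-leg ou)) (trans e (role-leg ow))) in leg-injective ou ow el ei

    edge⇒adj : ∀ {u w} → inPart π u ≡ true → inPart π w ≡ true → RoleEdge (role π u) (role π w) → adjIn π u w ≡ true
    edge⇒adj {u} {w} pu pw re with ∨-elim {isTopOf π u} pu
    ... | inj₁ tu = ⊥-elim (no-edge-from-top (subst (λ ρ → RoleEdge ρ (role π w)) (role-top {π} tu) re))
    ... | inj₂ ou = adjIn-up ou (role-injective (parent-inPart ou) pw
                      (roleEdge-functional (role-parent ou) re))

    adj⇒edge : ∀ {u w} → adjIn π u w ≡ true → RoleEdge (role π u) (role π w) ⊎ RoleEdge (role π w) (role π u)
    adj⇒edge {u} {w} a with adjIn-elim {π} a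
    ... | inj₁ (o , refl) = inj₁ (role-parent o)
    ... | inj₂ (o , refl) = inj₂ (role-parent o)

    Drawn : Role → Set
    Drawn ρ = Σ (Fin n) λ v → (inPart π v ≡ true) × (role π v ≡ ρ)

    drawn-top : Drawn top
    drawn-top = (topVertex , top-inPart , role-top {π} (top-of-leg x₀-inLeg))

    drawn-up : ∀ {l i} → Drawn (leg l (suc (suc i))) → Drawn (leg l (suc i))
    drawn-up {l} {i} (v , pv , e) with ∨-elim {isTopOf π v} pv
    ... | inj₁ tv = ⊥-elim (top≢leg (trans (sym (role-top {π} tv)) e))
    ... | inj₂ ov = parent v , parent-inPart ov ,
                    roleEdge-functional (subst (λ ρ → RoleEdge ρ (role π (parent v))) e (role-parent ov)) (next l i)

    disjoint-inPart : ∀ {u w} → u ≢ w → inPart π u ≡ true → inPart π w ≡ true → Disjoint (barOf π u) (barOf π w)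
    disjoint-inPart ne pu pw = disjoint-roles (offsetOf π) (role-valid pu) (role-valid pw) (λ e → ne (role-injective pu pw e))

    module InArrangement {m : ℕ} (R : BarAssignment m) (intHeights : ∀ c → ∃[ Y ] by (barAt R c) ≡ toℚ Y)
                         (contains : ∀ z → inPart π z ≡ true → Σ (Pos R) λ c → barAt R c ≡ barOf π z) where
      open RoleVisibility R intHeights (offsetOf π)

      adj⇒sees : ∀ {u w} → adjIn π u w ≡ true → SeeEachOther R (barOf π u) (barOf π w)
      adj⇒sees a with adj⇒edge a
      ... | inj₁ re = edge-sees re
      ... | inj₂ re = see-sym (edge-sees re)

      drawn-bar : ∀ {ρ} → Drawn ρ → Σ (Pos R) λ c → barAt R c ≡ roleBar (offsetOf π) ρ
      drawn-bar (v , pv , refl) = contains v pv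

      sees⇒adj : ∀ {u w} → inPart π u ≡ true → inPart π w ≡ true → SeesUp R (barOf π u) (barOf π w) → adjIn π u w ≡ true
      sees⇒adj {u} {w} pu pw s =
        [ edge⇒adj pu pw , (λ re → adjIn-sym π w u (edge⇒adj pw pu re)) ]′
        (sees⇒edge Drawn drawn-top drawn-up drawn-bar (role-valid pu) (role-valid pw) (u , pu , refl) (w , pw , refl) s)

-- Assembly: the decomposition, its load, and the global representation

module Assembly {n : ℕ} (TG : Graph n) (allV : ∀ v → vert TG v ≡ true) (tr : IsTree TG) where
  open SpiderDrawing TG allV tr

  -- Spider codes lie below n · base; `parts` lists the occupied ones.

  codeBound : ℕ
  codeBound = n * base

  occupiedᵇ : ℕ → Bool
  occupiedᵇ π = anyFin (λ x → inLeg π x)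

  parts : List ℕ
  parts = keep occupiedᵇ (downFrom codeBound)

  parts-unique : Unique parts
  parts-unique = keep-Unique occupiedᵇ (downFrom codeBound) (UP.downFrom⁺ codeBound)

  parts-occupied : ∀ {π} → π ∈ parts → Occupied π
  parts-occupied {π} m =
    let (x , o) = anyFin-elim (λ x → inLeg π x) (proj₂ (keep-∈⁻ occupiedᵇ (downFrom codeBound) m))
        (ne , e) = inLeg-elim o
    in x , ne , e

  owner<codeBound : ∀ {x} → x ≢ r → owner x < codeBound
  owner<codeBound {x} ne = NP.<-≤-trans (NP.+-monoʳ-< (t * base) (group<base ne))
    (NP.≤-trans (NP.≤-reflexive (NP.+-comm (t * base) base)) (NP.*-monoˡ-≤ base (FP.toℕ<n (topOf (place x)))))
    where
    t : ℕ
    t = F.toℕ (topOf (place x))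

  owner∈parts : ∀ {x} → x ≢ r → owner x ∈ parts
  owner∈parts {x} ne = keep-∈⁺ occupiedᵇ (MP.∈-downFrom⁺ (owner<codeBound ne))
    (anyFin-intro (λ y → inLeg (owner x) y) x (inLeg-intro ne refl))

  ind-Fin-unique : ∀ b → (i j : Fin (ind b)) → i ≡ j
  ind-Fin-unique true fzero fzero = refl

  ind-Fin-true : ∀ {b} → Fin (ind b) → b ≡ true
  ind-Fin-true {true} _ = refl

  ind-Fin : ∀ {b} → b ≡ true → Fin (ind b)
  ind-Fin refl = fzero

  module AloneDrawing (π : ℕ) (occ : Occupied π) where

    R : BarAssignment n
    R = record { nb = λ v → ind (inPart π v) ; bar = λ v _ → barOf π v }

    contains : ∀ z → inPart π z ≡ true → Σ (Pos R) λ c → barAt R c ≡ barOf π z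
    contains z p = (z , ind-Fin p) , refl

    intHeights : ∀ c → ∃[ Y ] by (barAt R c) ≡ toℚ Y
    intHeights (v , _) = roleY (role π v) , refl

    open InArrangement π occ R intHeights contains

    disjoint : ∀ (c d : Pos R) → c ≢ d → Disjoint (barAt R c) (barAt R d)
    disjoint (u , i) (w , j) ne with u F.≟ w
    ... | yes refl = ⊥-elim (ne (cong (u ,_) (ind-Fin-unique (inPart π u) i j)))
    ... | no uw = disjoint-inPart π occ uw (ind-Fin-true i) (ind-Fin-true j)

    isRep : IsRep 1 (spider π) R
    isRep = (λ v → ind≤1 (inPart π v)) , (λ v e → cong ind e) , disjoint ,
            (λ u w pu pw _ → mk⇔
               (λ a → ind-Fin pu , ind-Fin pw , adj⇒sees a)
               (λ { (i , j , inj₁ s) → sees⇒adj pu pw s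
                  ; (i , j , inj₂ s) → adjIn-sym π w u (sees⇒adj pw pu s) }))

  -- The decomposition: every edge is the parent edge of a unique leg vertex.

  partAt : Fin (length parts) → ℕ
  partAt i = lookup parts i

  partAt-occupied : ∀ i → Occupied (partAt i)
  partAt-occupied i = parts-occupied (MP.∈-lookup i)

  covered : ∀ u v → adj TG u v ≡ true → ∃[ i ] adjIn (partAt i) u v ≡ true
  covered u v a with edge-is-parent-edge a
  ... | inj₁ (vnr , pv) = let m = owner∈parts vnr in
    index m , subst (λ π → adjIn π u v ≡ true) (lookup-index m) (adjIn-down (inLeg-intro vnr refl) pv)
  ... | inj₂ (unr , pu) = let m = owner∈parts unr in
    index m , subst (λ π → adjIn π u v ≡ true) (lookup-index m) (adjIn-up (inLeg-intro unr refl) pu)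

  -- Two listed spiders sharing a leg vertex coincide: both codes are its owner.
  sameOwner : ∀ {i j x} → inLeg (partAt i) x ≡ true → inLeg (partAt j) x ≡ true → i ≡ j
  sameOwner {i} {j} oi oj = lookup-injective parts parts-unique i j (trans (sym (proj₂ (inLeg-elim oi))) (proj₂ (inLeg-elim oj)))

  uniquelyCovered : ∀ u v i j → adjIn (partAt i) u v ≡ true → adjIn (partAt j) u v ≡ true → i ≡ j
  uniquelyCovered u v i j ai aj with adjIn-elim {partAt i} ai | adjIn-elim {partAt j} aj
  ... | inj₁ (oi , _) | inj₁ (oj , _) = sameOwner oi oj
  ... | inj₂ (oi , _) | inj₂ (oj , _) = sameOwner oi oj
  ... | inj₁ (oi , e1) | inj₂ (oj , e2) = ⊥-elim (parent-asym (proj₁ (inLeg-elim oi)) (proj₁ (inLeg-elim oj)) e1 e2)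
  ... | inj₂ (oi , e1) | inj₁ (oj , e2) = ⊥-elim (parent-asym (proj₁ (inLeg-elim oj)) (proj₁ (inLeg-elim oi)) e2 e1)

  decomposition : Decomposition TG
  decomposition = record
    { k = length parts
    ; part = λ i → spider (partAt i)
    ; sub = λ i u v p → ∧-elimˡ p
    ; ubvt = λ i → SpiderTree.spider-isTree (partAt i) (partAt-occupied i) ,
                   (AloneDrawing.R (partAt i) (partAt-occupied i) , AloneDrawing.isRep (partAt i) (partAt-occupied i))
    ; cover = covered
    ; uniq = uniquelyCovered
    }

  -- Load.  Vertex v lies in its own spider (if v ≠ r) and in the spiders it
  -- tops, whose codes lie in  [v·base + firstGroup v, v·base + endGroup v).

  rootShift : Fin n → ℕ
  rootShift v = if eqFin v r then 0 else 2

  firstGroup : Fin n → ℕ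
  firstGroup v = if eqFin v r then 0 else 1

  endGroup : Fin n → ℕ
  endGroup v = (childCount v + 2 + rootShift v) / 3

  [n+3]/3 : ∀ a → (a + 3) / 3 ≡ suc (a / 3)
  [n+3]/3 a = trans (m/n≡1+[m∸n]/n (NP.m≤n+m 3 a)) (cong (λ t → suc (t / 3)) (NP.m+n∸n≡m a 3))

  childGroup<endGroup : ∀ {L v} → L ≢ r → parent L ≡ v → childGroup L < endGroup v
  childGroup<endGroup {L} {v} ne e =
    subst (_≤ endGroup v) ([n+3]/3 (rank L + shift L))
      (/-monoˡ-≤ 3 (subst (λ t → rank L + t + 3 ≤ childCount v + 2 + rootShift v) (sym shift≡)
        (subst (_≤ childCount v + 2 + rootShift v) (sym (rearrange (rank L) (rootShift v)))
          (NP.+-monoˡ-≤ (rootShift v) (NP.+-monoˡ-≤ 2 rank<)))))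
    where
    shift≡ : shift L ≡ rootShift v
    shift≡ = cong (λ p → if eqFin p r then 0 else 2) e
    rank< : suc (rank L) ≤ childCount v
    rank< = subst (λ p → suc (rank L) ≤ childCount p) e (rank<childCount ne)
    rearrange : ∀ a b → a + b + 3 ≡ suc a + 2 + b
    rearrange = solve-∀

  -- A child starting a new leg below a non-root vertex has rank ≥ 1, hence group ≥ 1.
  firstGroup≤childGroup : ∀ {L v} → L ≢ r → continues L ≡ false → parent L ≡ v → firstGroup v ≤ childGroup L
  firstGroup≤childGroup {L} {v} ne c e with eqFin v r in ev
  ... | true = z≤n
  ... | false = subst (λ t → 1 ≤ (rank L + t) / 3) (sym shift≡) (/-monoˡ-≤ 3 (NP.+-monoˡ-≤ 2 (rank≥1 (rank L) rank≢0)))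
    where
    shift≡ : shift L ≡ 2
    shift≡ = trans (cong (λ p → if eqFin p r then 0 else 2) e) (cong (λ b → if b then 0 else 2) ev)
    rank≢0 : (rank L ≡ᵇ 0) ≡ false
    rank≢0 = subst (λ b → not b ∧ (rank L ≡ᵇ 0) ≡ false) (trans (cong (λ p → eqFin p r) e) ev) c
    rank≥1 : ∀ k → (k ≡ᵇ 0) ≡ false → 1 ≤ k
    rank≥1 (suc k) _ = s≤s z≤n

  inRange : Fin n → ℕ → Bool
  inRange v π = ((F.toℕ v * base + firstGroup v) ≤ᵇ π) ∧ (π <ᵇ (F.toℕ v * base + endGroup v))

  top⇒inRange : ∀ v π → π ∈ parts → ind (isTopOf π v) ≤ ind (inRange v π)
  top⇒inRange v π m with isTopOf π v in tp
  ... | false = z≤n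
  ... | true = NP.≤-reflexive (cong ind (sym (∧-intro {(A₀ + firstGroup v) ≤ᵇ π} {π <ᵇ (A₀ + endGroup v)}
                 (≤ᵇ-true (subst (A₀ + firstGroup v ≤_) (sym π≡) (NP.+-monoʳ-≤ A₀ (firstGroup≤childGroup start≢r start-new pv))))
                 (<ᵇ-true (subst (_< A₀ + endGroup v) (sym π≡) (NP.+-monoʳ-< A₀ (childGroup<endGroup start≢r pv)))))))
    where
    x : Fin n
    x = proj₁ (parts-occupied m)
    ne : x ≢ r
    ne = proj₁ (proj₂ (parts-occupied m))
    open LegStart (legStart x ne)
    tv : v ≡ topOf (place x)
    tv = top-unique (inLeg-intro ne (proj₂ (proj₂ (parts-occupied m)))) tp
    pv : parent start ≡ v
    pv = trans (sym top≡) (sym tv)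
    π≡ : π ≡ F.toℕ v * base + childGroup start
    π≡ = trans (sym (proj₂ (proj₂ (parts-occupied m)))) (cong₂ (λ a b → F.toℕ a * base + b) (sym tv) group≡)
    A₀ : ℕ
    A₀ = F.toℕ v * base

  membership : Fin n → ℕ
  membership v = sumMap (λ π → ind (inPart π v)) parts

  leg-memberships : ∀ v → sumMap (λ π → ind (inLeg π v)) parts ≤ ind (not (eqFin v r))
  leg-memberships v with eqFin v r
  ... | true = NP.≤-reflexive (sumMap-zero _ parts (λ _ _ → refl))
  ... | false = count-unique≤1 (owner v) parts parts-unique

  top-memberships : ∀ v → sumMap (λ π → ind (isTopOf π v)) parts ≤ endGroup v ∸ firstGroup v
  top-memberships v = NP.≤-trans (sumMap-mono (λ π → ind (isTopOf π v)) (λ π → ind (inRange v π)) parts (top⇒inRange v))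
    (NP.≤-trans (sumMap-keep-≤ occupiedᵇ (λ π → ind (inRange v π)) (downFrom codeBound))
      (NP.≤-trans (count-interval (A₀ + firstGroup v) (A₀ + endGroup v) codeBound)
        (NP.≤-reflexive (NP.[m+n]∸[m+o]≡n∸o A₀ (endGroup v) (firstGroup v)))))
    where
    A₀ : ℕ
    A₀ = F.toℕ v * base

  membership≤ : ∀ v → membership v ≤ (endGroup v ∸ firstGroup v) + ind (not (eqFin v r))
  membership≤ v = NP.≤-trans (sumMap-mono _ (λ π → ind (isTopOf π v) + ind (inLeg π v)) parts (λ π _ → ind-∨ (isTopOf π v) (inLeg π v)))
    (NP.≤-trans (NP.≤-reflexive (sumMap-+ (λ π → ind (isTopOf π v)) (λ π → ind (inLeg π v)) parts))
      (NP.+-mono-≤ (top-memberships v) (leg-memberships v)))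

  root-load : ∀ c d → c ≤ d → (c + 2 + 0) / 3 ∸ 0 + 0 ≤ ceil3 (d + 1)
  root-load c d le = subst (_≤ ceil3 (d + 1)) (sym (NP.+-identityʳ ((c + 2 + 0) / 3)))
    (/-monoˡ-≤ 3 (NP.≤-trans (NP.≤-reflexive (NP.+-identityʳ (c + 2))) (NP.+-monoˡ-≤ 2 (NP.≤-trans le (NP.m≤m+n d 1)))))

  nonroot-load : ∀ c d → c + 1 ≤ d → (c + 2 + 2) / 3 ∸ 1 + 1 ≤ ceil3 (d + 1)
  nonroot-load c d le = begin
    (c + 2 + 2) / 3 ∸ 1 + 1  ≡⟨ NP.m∸n+n≡m 1≤ ⟩
    (c + 2 + 2) / 3          ≤⟨ /-monoˡ-≤ 3 (subst₂ _≤_ (sym (c+4 c)) (sym (d+3 d)) (NP.+-monoˡ-≤ 3 le)) ⟩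
    ceil3 (d + 1)            ∎
    where
    open NP.≤-Reasoning
    c+4 : ∀ c → c + 2 + 2 ≡ c + 1 + 3
    c+4 = solve-∀
    d+3 : ∀ d → d + 1 + 2 ≡ d + 3
    d+3 = solve-∀
    1≤ : 1 ≤ (c + 2 + 2) / 3
    1≤ = subst (1 ≤_) (sym (trans (cong (_/ 3) (c+4 c)) ([n+3]/3 (c + 1)))) (s≤s z≤n)

  degFin : Fin n → ℕ
  degFin v = sumFin (λ w → ind (adj TG v w))

  membership≤ceil3 : ∀ v → membership v ≤ ceil3 (degree TG v + 1)
  membership≤ceil3 v = NP.≤-trans (membership≤ v)
    (subst (λ d → (endGroup v ∸ firstGroup v) + ind (not (eqFin v r)) ≤ ceil3 (d + 1))
           (sumFin≡sum (λ w → ind (adj TG v w))) (byRoot (eqFin v r) refl))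
    where
    byRoot : (b : Bool) → eqFin v r ≡ b → (endGroup v ∸ firstGroup v) + ind (not (eqFin v r)) ≤ ceil3 (degFin v + 1)
    byRoot b e = subst (λ b → (childCount v + 2 + (if b then 0 else 2)) / 3 ∸ (if b then 0 else 1) + ind (not b) ≤ ceil3 (degFin v + 1))
      (sym e) (bound b (subst (λ b → childCount v + ind (not b) ≤ degFin v) e (children+parent≤degree v)))
      where
      bound : ∀ b → childCount v + ind (not b) ≤ degFin v →
        (childCount v + 2 + (if b then 0 else 2)) / 3 ∸ (if b then 0 else 1) + ind (not b) ≤ ceil3 (degFin v + 1)
      bound true le = root-load (childCount v) (degFin v) (NP.≤-trans (NP.≤-reflexive (sym (NP.+-identityʳ (childCount v)))) le)
      bound false le = nonroot-load (childCount v) (degFin v) le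

  decomposition-load : ∀ v → load decomposition v ≤ ceil3 (degree TG v + 1)
  decomposition-load v = subst (_≤ ceil3 (degree TG v + 1)) (sym (sum-allFin-lookup (λ π → ind (inPart π v)) parts))
    (membership≤ceil3 v)

  partsOf : Fin n → List ℕ
  partsOf v = keep (λ π → inPart π v) parts

  partsOf-∈ : ∀ {v π} → π ∈ partsOf v → (π ∈ parts) × (inPart π v ≡ true)
  partsOf-∈ {v} m = keep-∈⁻ (λ π → inPart π v) parts m

  globalRep : BarAssignment n
  globalRep = record { nb = λ v → length (partsOf v) ; bar = λ v i → barOf (lookup (partsOf v) i) v }

  partOfBar : Pos globalRep → ℕ
  partOfBar (v , i) = lookup (partsOf v) i

  partOfBar-∈ : ∀ c → (partOfBar c ∈ parts) × (inPart (partOfBar c) (proj₁ c) ≡ true)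
  partOfBar-∈ (v , i) = partsOf-∈ {v} (MP.∈-lookup {xs = partsOf v} i)

  globalRep-intHeights : ∀ c → ∃[ Y ] by (barAt globalRep c) ≡ toℚ Y
  globalRep-intHeights (v , i) = roleY (role (lookup (partsOf v) i) v) , refl

  globalRep-contains : ∀ {π} → π ∈ parts → ∀ z → inPart π z ≡ true → Σ (Pos globalRep) λ c → barAt globalRep c ≡ barOf π z
  globalRep-contains {π} mπ z pz = let m = keep-∈⁺ (λ π → inPart π z) mπ pz in
    (z , index m) , cong (λ p → barOf p z) (sym (lookup-index m))

  offsets-apart : ∀ p p' a b → a ≤ 12 → p < p' → offsetOf p + a + 10 < offsetOf p' + b
  offsets-apart p p' a b a≤12 lt =
    NP.≤-<-trans (NP.≤-trans (NP.≤-reflexive (NP.+-assoc (50 * p) a 10)) (NP.+-monoʳ-≤ (50 * p) (NP.+-monoˡ-≤ 10 a≤12)))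
      (NP.<-≤-trans next-offset (NP.≤-trans (NP.*-monoʳ-≤ 50 lt) (NP.m≤m+n (50 * p') b)))
    where
    next-offset : 50 * p + 22 < 50 * suc p
    next-offset = subst (50 * p + 22 <_) (trans (NP.+-comm (50 * p) 50) (sym (NP.*-suc 50 p))) (NP.+-monoʳ-< (50 * p) (NP.m≤m+n 23 27))

  xOf : ℕ → Fin n → ℕ
  xOf π v = offsetOf π + roleX (role π v)

  parts-separated : ∀ {p p'} u w → p < p' → xOf p u + 10 < xOf p' w
  parts-separated {p} {p'} u w lt = offsets-apart p p' (roleX (role p u)) (roleX (role p' w)) (roleX≤12 (role p u)) lt

  same-part : ∀ {p p'} u w → xOf p' w < xOf p u + 10 → xOf p u < xOf p' w + 10 → p ≡ p'
  same-part {p} {p'} u w h1 h2 with NP.<-cmp p p'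
  ... | tri< lt _ _ = ⊥-elim (NP.<-asym h1 (parts-separated u w lt))
  ... | tri≈ _ e _ = e
  ... | tri> _ _ gt = ⊥-elim (NP.<-asym h2 (parts-separated w u gt))

  globalRep-disjoint : ∀ (c d : Pos globalRep) → c ≢ d → Disjoint (barAt globalRep c) (barAt globalRep d)
  globalRep-disjoint (u , i) (w , j) ne with NP.<-cmp (partOfBar (u , i)) (partOfBar (w , j))
  ... | tri< lt _ _ = grid-disjoint (inj₂ (inj₁ (parts-separated u w lt)))
  ... | tri> _ _ gt = grid-disjoint (inj₂ (inj₂ (parts-separated w u gt)))
  ... | tri≈ _ e _ with u F.≟ w
  ...   | yes refl = ⊥-elim (ne (cong (u ,_) (lookup-injective (partsOf u) (keep-Unique (λ π → inPart π u) parts parts-unique) i j e)))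
  ...   | no uw =
    let (mu , pu) = partOfBar-∈ (u , i) ; (_ , pw) = partOfBar-∈ (w , j)
    in subst (λ p → Disjoint (barOf (partOfBar (u , i)) u) (barOf p w)) e
         (disjoint-inPart (partOfBar (u , i)) (parts-occupied mu) uw pu (subst (λ p → inPart p w ≡ true) (sym e) pw))

  -- Bars that see each other belong to one spider, where visibility is adjacency.
  globalRep-sees⇒adj : ∀ (c d : Pos globalRep) → SeesUp globalRep (barAt globalRep c) (barAt globalRep d) →
    adj TG (proj₁ c) (proj₁ d) ≡ true
  globalRep-sees⇒adj (u , i) (w , j) s = ∧-elimˡ (InArrangement.sees⇒adj p (parts-occupied mu) globalRep
      globalRep-intHeights (globalRep-contains mu) pu (subst (λ q → inPart q w ≡ true) (sym e) pw)
      (subst (λ q → SeesUp globalRep (barOf p u) (barOf q w)) (sym e) s))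
    where
    p p' : ℕ
    p = partOfBar (u , i)
    p' = partOfBar (w , j)
    e : p ≡ p'
    e = let (h1 , h2 , _) = seesUp-overlap globalRep {xOf p u} {roleY (role p u)} {xOf p' w} {roleY (role p' w)} s
        in same-part u w h1 h2
    mu : p ∈ parts
    mu = proj₁ (partOfBar-∈ (u , i))
    pu : inPart p u ≡ true
    pu = proj₂ (partOfBar-∈ (u , i))
    pw : inPart p' w ≡ true
    pw = proj₂ (partOfBar-∈ (w , j))

  adj⇒globalRep-sees : ∀ u w → adj TG u w ≡ true → ∃[ i ] ∃[ j ] SeeEachOther globalRep (bar globalRep u i) (bar globalRep w j)
  adj⇒globalRep-sees u w a =
    let (k , ak) = covered u w a
        mπ = MP.∈-lookup {xs = parts} k
        (pu , pw) = adjIn-inPart (partAt k) u w ak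
        mu = keep-∈⁺ (λ q → inPart q u) mπ pu
        mw = keep-∈⁺ (λ q → inPart q w) mπ pw
    in index mu , index mw ,
       subst₂ (SeeEachOther globalRep) (cong (λ q → barOf q u) (lookup-index mu)) (cong (λ q → barOf q w) (lookup-index mw))
         (InArrangement.adj⇒sees (partAt k) (parts-occupied mπ) globalRep globalRep-intHeights (globalRep-contains mπ) ak)

  degree≤maxDegree : ∀ v → degree TG v ≤ maxDegree TG
  degree≤maxDegree v = below (allFin n) (MP.∈-allFin v)
    where
    below : ∀ xs → v ∈ xs → degree TG v ≤ foldr N._⊔_ 0 (map (degree TG) xs)
    below (x ∷ xs) (here refl) = NP.m≤m⊔n _ _
    below (x ∷ xs) (there m) = NP.≤-trans (below xs m) (NP.m≤n⊔m _ _)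

  globalRep-bars : ∀ v → length (partsOf v) ≤ ceil3 (maxDegree TG + 1)
  globalRep-bars v = NP.≤-trans (NP.≤-reflexive (length-keep (λ π → inPart π v) parts))
    (NP.≤-trans (membership≤ceil3 v) (/-monoˡ-≤ 3 (NP.+-monoˡ-≤ 2 (NP.+-monoˡ-≤ 1 (degree≤maxDegree v)))))

  globalRep-isRep : IsRep (ceil3 (maxDegree TG + 1)) TG globalRep
  globalRep-isRep = globalRep-bars , (λ v e → ⊥-elim (true≢false (allV v) e)) , globalRep-disjoint ,
    (λ u w _ _ _ → mk⇔ (adj⇒globalRep-sees u w)
       (λ { (i , j , inj₁ s) → globalRep-sees⇒adj (u , i) (w , j) s
          ; (i , j , inj₂ s) → Adj-sym (globalRep-sees⇒adj (w , j) (u , i) s) }))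

theorem6 : (n : ℕ) (T : Graph n) → (∀ v → vert T v ≡ true) → IsTree T →
    Σ (Decomposition T) (λ D → ∀ v → load D v ≤ ceil3 (degree T v + 1))
    × HasRep (ceil3 (maxDegree T + 1)) T
theorem6 n T allV tree = (decomposition , decomposition-load) , (globalRep , globalRep-isRep)
  where open Assembly T allV tree
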